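{- Let $P,Q$ be integers with $Q\ne0$, $U=U(P,Q)$, $V=V(P,Q)$, $D=P^2-4Q$. Let $p\ge7$ be a prime of maximal rank, i.e. $p\nmid Q$ and the rank of appearance $\rho$ of $p$ in $U$ equals $p-\epsilon_p$ with $\epsilon_p=(D\mid p)$. Define $$\Sigma_{1,1,1}=\sum_{0<r<s<t<\rho}\frac{V_rV_sV_t}{U_rU_sU_t},\qquad \Sigma_{1,1,1,1}=\sum_{0<q<r<s<t<\rho}\frac{V_qV_rV_sV_t}{U_qU_rU_sU_t}.$$ Then $\Sigma_{1,1,1}\equiv0\pmod{p^2}$, and $\Sigma_{1,1,1,1}\equiv0\pmod p$ if $\epsilon_p\in\{0,-1\}$, while $\Sigma_{1,1,1,1}\equiv D^2\pmod p$ if $\epsilon_p=1$.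
   Context: For integers $P,Q$ with $Q\ne0$, $U(P,Q)$ is given by $U_0=0$, $U_1=1$, $U_{n+2}=PU_{n+1}-QU_n$, and $V(P,Q)$ by the same recurrence with $V_0=2$, $V_1=P$. $(D\mid p)$ is the Legendre symbol. The rank of appearance of $p$ in $U$ is the least positive $t$ with $p\mid U_t$. Congruences between rationals with denominators prime to $p$ are in the $p$-adic sense. -}

module Defs where

open import Data.Nat as ℕ using (ℕ; zero; suc; _<_)
open import Data.Integer as ℤ using (ℤ; +_; +[1+_]; -[1+_]; -_)
open import Data.Integer.Divisibility as ℤD using ()
open import Data.Nat.Divisibility as ℕD using ()
open import Data.Rational as ℚ using (ℚ; 0ℚ; ↥_; ↧ₙ_)
open import Data.Product using (Σ; ∃; _×_)
open import Relation.Nullary using (¬_)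

U : ℤ → ℤ → ℕ → ℤ
U P Q zero = + 0
U P Q (suc zero) = + 1
U P Q (suc (suc n)) = P ℤ.* U P Q (suc n) ℤ.- Q ℤ.* U P Q n

V : ℤ → ℤ → ℕ → ℤ
V P Q zero = + 2
V P Q (suc zero) = P
V P Q (suc (suc n)) = P ℤ.* V P Q (suc n) ℤ.- Q ℤ.* V P Q n

-- a / b as a rational number; convention a / 0 = 0 (never used: the
-- denominators occurring in the statement are nonzero)
divℤ : ℤ → ℤ → ℚ
divℤ a (+ zero) = 0ℚ
divℤ a +[1+ n ] = a ℚ./ suc n
divℤ a -[1+ n ] = (- a) ℚ./ suc n

-- Legendre symbol (D | p) as a relation: Legendre D p e  means  (D | p) = e
data Legendre (D : ℤ) (p : ℕ) : ℤ → Set where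
  leg-zero  : (+ p) ℤD.∣ D → Legendre D p (+ 0)
  leg-plus  : ¬ ((+ p) ℤD.∣ D) → (∃ λ x → (+ p) ℤD.∣ (x ℤ.* x ℤ.- D)) → Legendre D p (+ 1)
  leg-minus : ¬ ((+ p) ℤD.∣ D) → ¬ (∃ λ x → (+ p) ℤD.∣ (x ℤ.* x ℤ.- D)) → Legendre D p (ℤ.- (+ 1))

IsRank : ℤ → ℤ → ℕ → ℕ → Set
IsRank P Q p ρ = (0 < ρ) × ((+ p) ℤD.∣ U P Q ρ)
               × (∀ t → 0 < t → t < ρ → ¬ ((+ p) ℤD.∣ U P Q t))

-- S n f = Σ_{0 < i < n} f i
S : ℕ → (ℕ → ℚ) → ℚ
S zero f = 0ℚ
S (suc zero) f = 0ℚ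
S (suc (suc n)) f = S (suc n) f ℚ.+ f (suc n)

-- x ≡ y (mod p^k) p-adically, for rationals with denominators prime to p
CongQ : ℕ → ℕ → ℚ → ℚ → Set
CongQ p k x y = ¬ (p ℕD.∣ ↧ₙ x) × ¬ (p ℕD.∣ ↧ₙ y)
              × ((p ℕ.^ k) ℕD.∣ ℤ.∣ ↥ (x ℚ.- y) ∣)

w : ℤ → ℤ → ℕ → ℚ
w P Q n = divℤ (V P Q n) (U P Q n)

Σ111 : ℤ → ℤ → ℕ → ℚ
Σ111 P Q ρ = S ρ (λ t → S t (λ s → S s (λ r → w P Q r ℚ.* w P Q s ℚ.* w P Q t)))

Σ1111 : ℤ → ℤ → ℕ → ℚ
Σ1111 P Q ρ = S ρ (λ t → S t (λ s → S s (λ r → S r (λ q →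
  w P Q q ℚ.* w P Q r ℚ.* w P Q s ℚ.* w P Q t))))

{-# OPTIONS --safe #-}
module Submission where

-- Write w n = V n / U n and L = ρ - 1. As p ∤ U 1 , … , U L, the w a (0 < a < ρ) are
-- p-integral, and clearing denominators in the addition formulas
-- 2 U (a + b) = U a V b + U b V a and 2 V (a + b) = V a V b + D U a U b gives, modulo p²,
--   V ρ (w a + w b) ≡ U ρ (D + w a w b)          for a + b = ρ,
--   w a w b - w (a + b) (w a + w b) + D ≡ 0      for a + b < ρ.
-- Since p ∣ U ρ and p ∤ V ρ, the first gives w (ρ - a) ≡ - w a (mod p), and then the second
-- becomes w a w b + w b w c + w c w a + D ≡ 0 (mod p) for a + b + c = ρ.
-- The reflection kills the odd power sums s₁, s₃ of the w a modulo p. Splitting the products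
-- s₁², s₃ s₁, s₂² and (ρ - 1) s₂ over the square [1, L]² into two reflected triangles and the
-- antidiagonal, and summing the three-term relation over the triangle, expresses s₂ and s₄
-- modulo p through D and ρ. Newton's identities then give 360 e₄ as a polynomial in D and ρ
-- modulo p, and, using the first relation modulo p² once more for s₁ and s₃, 12 V ρ e₃ ≡ U ρ β
-- (mod p²) with 15 β a polynomial in D and ρ modulo p. Since Σ₁₁₁ = e₃ and Σ₁₁₁₁ = e₄, it
-- remains to evaluate these polynomials when p ∣ D, ρ = p - 1 and ρ = p + 1.

open import Defs
open import Data.Nat as ℕ using (ℕ; zero; suc; _<_; _≤_; _∸_; s≤s; z≤n)
import Data.Nat.Properties as ℕP
open import Data.Nat.Tactic.RingSolver renaming (solve-∀ to solve-∀ℕ)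
import Data.Nat.Divisibility as ℕD
open import Data.Nat.Coprimality as Coprimality using (Coprime; coprime-Bézout)
open import Data.Nat.GCD using (module Bézout)
open import Data.Nat.Primality using (Prime; euclidsLemma; prime⇒irreducible; ¬prime[1])
open import Data.Integer as ℤ using (ℤ; +_; +[1+_]; -[1+_]; _-_; _*_; _+_; -_; _^_; 0ℤ; 1ℤ)
import Data.Integer.Properties as ℤP
open import Data.Integer.GCD using (gcd)
open import Data.Integer.Divisibility as ℤD using ()
open import Data.Integer.Divisibility.Signed
  using (_∣_; _∣?_; divides; ∣-refl; ∣ᵤ⇒∣; ∣⇒∣ᵤ; ∣m∣n⇒∣m+n; ∣m∣n⇒∣m-n; ∣m⇒∣-m; ∣n⇒∣m*n; ∣m⇒∣m*n)
open import Data.Integer.Tactic.RingSolver using (solve-∀)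
open import Data.Rational as ℚ using (ℚ; mkℚ; ↥_; ↧_; ↧ₙ_; _/_; 0ℚ)
import Data.Rational.Properties as ℚP
open import Data.Product using (_×_; _,_)
open import Data.Sum using (_⊎_; inj₁; inj₂)
open import Data.Empty using (⊥-elim)
open import Function using (_$_)
open import Relation.Nullary using (¬_; yes; no)
open import Relation.Nullary.Decidable using (True; toWitness)
open import Relation.Binary.Bundles using (Setoid)
open import Relation.Binary.Structures using (IsEquivalence)
open import Relation.Binary.PropositionalEquality
  using (_≡_; _≢_; refl; sym; trans; cong; cong₂; subst; module ≡-Reasoning)


-- Congruences of integers

infix 4 _≡_mod_

record _≡_mod_ (a b m : ℤ) : Set where
  constructor ≡-mod
  field ∣-difference : m ∣ a - b
open _≡_mod_ public

∣-subst : ∀ {m x y} → x ≡ y → m ∣ x → m ∣ y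
∣-subst {m} = subst (m ∣_)

module _ {m : ℤ} where

  mod-refl : ∀ {a} → a ≡ a mod m
  mod-refl {a} = ≡-mod (divides 0ℤ (ℤP.+-inverseʳ a))

  mod-reflexive : ∀ {a b} → a ≡ b → a ≡ b mod m
  mod-reflexive refl = mod-refl

  mod-sym : ∀ {a b} → a ≡ b mod m → b ≡ a mod m
  mod-sym {a} {b} (≡-mod d) = ≡-mod (∣-subst (identity a b) (∣m⇒∣-m d))
    where identity : ∀ a b → - (a - b) ≡ b - a
          identity = solve-∀

  mod-trans : ∀ {a b c} → a ≡ b mod m → b ≡ c mod m → a ≡ c mod m
  mod-trans {a} {b} {c} (≡-mod d) (≡-mod e) = ≡-mod (∣-subst (identity a b c) (∣m∣n⇒∣m+n d e))
    where identity : ∀ a b c → (a - b) + (b - c) ≡ a - c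
          identity = solve-∀

  mod-isEquivalence : IsEquivalence (λ a b → a ≡ b mod m)
  mod-isEquivalence = record { refl = mod-refl ; sym = mod-sym ; trans = mod-trans }

  +-cong-mod : ∀ {a b c d} → a ≡ b mod m → c ≡ d mod m → a + c ≡ b + d mod m
  +-cong-mod {a} {b} {c} {d} (≡-mod x) (≡-mod y) = ≡-mod (∣-subst (identity a b c d) (∣m∣n⇒∣m+n x y))
    where identity : ∀ a b c d → (a - b) + (c - d) ≡ (a + c) - (b + d)
          identity = solve-∀

  *-cong-mod : ∀ {a b c d} → a ≡ b mod m → c ≡ d mod m → a * c ≡ b * d mod m
  *-cong-mod {a} {b} {c} {d} (≡-mod x) (≡-mod y) =
    ≡-mod (∣-subst (identity a b c d) (∣m∣n⇒∣m+n (∣m⇒∣m*n c x) (∣n⇒∣m*n b y)))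
    where identity : ∀ a b c d → (a - b) * c + b * (c - d) ≡ a * c - b * d
          identity = solve-∀

  neg-cong-mod : ∀ {a b} → a ≡ b mod m → - a ≡ - b mod m
  neg-cong-mod {a} {b} (≡-mod x) = ≡-mod (∣-subst (identity a b) (∣m⇒∣-m x))
    where identity : ∀ a b → - (a - b) ≡ - a - - b
          identity = solve-∀

  sub-cong-mod : ∀ {a b c d} → a ≡ b mod m → c ≡ d mod m → a - c ≡ b - d mod m
  sub-cong-mod x y = +-cong-mod x (neg-cong-mod y)

  *-congˡ-mod : ∀ c {a b} → a ≡ b mod m → c * a ≡ c * b mod m
  *-congˡ-mod c = *-cong-mod (mod-refl {c})

  *-congʳ-mod : ∀ c {a b} → a ≡ b mod m → a * c ≡ b * c mod m
  *-congʳ-mod c x = *-cong-mod x (mod-refl {c})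

  +-congˡ-mod : ∀ c {a b} → a ≡ b mod m → c + a ≡ c + b mod m
  +-congˡ-mod c = +-cong-mod (mod-refl {c})

  +-congʳ-mod : ∀ c {a b} → a ≡ b mod m → a + c ≡ b + c mod m
  +-congʳ-mod c x = +-cong-mod x (mod-refl {c})

  mod-0⇒∣ : ∀ {a} → a ≡ 0ℤ mod m → m ∣ a
  mod-0⇒∣ {a} (≡-mod x) = ∣-subst (ℤP.+-identityʳ a) x

  ∣⇒mod-0 : ∀ {a} → m ∣ a → a ≡ 0ℤ mod m
  ∣⇒mod-0 {a} x = ≡-mod (∣-subst (sym (ℤP.+-identityʳ a)) x)

mod-setoid : ℤ → Setoid _ _
mod-setoid m = record { isEquivalence = mod-isEquivalence {m} }

module mod-Reasoning (m : ℤ) where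
  open import Relation.Binary.Reasoning.Setoid (mod-setoid m) public

∣∧∣⇒*∣* : ∀ {p q x y} → p ∣ x → q ∣ y → p * q ∣ x * y
∣∧∣⇒*∣* {p} {q} (divides k refl) (divides l refl) = divides (k * l) (identity k l p q)
  where identity : ∀ k l p q → (k * p) * (l * q) ≡ (k * l) * (p * q)
        identity = solve-∀

*∣⇒∣ : ∀ {p q x} → p * q ∣ x → p ∣ x
*∣⇒∣ {p} {q} (divides k refl) = divides (k * q) (identity k p q)
  where identity : ∀ k p q → k * (p * q) ≡ (k * q) * p
        identity = solve-∀

mod-*⇒mod : ∀ {p q a b} → a ≡ b mod p * q → a ≡ b mod p
mod-*⇒mod (≡-mod x) = ≡-mod (*∣⇒∣ x)

∣⇒*-congˡ-mod² : ∀ {p u x y} → p ∣ u → x ≡ y mod p → u * x ≡ u * y mod p * p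
∣⇒*-congˡ-mod² {p} {u} {x} {y} p∣u (≡-mod p∣x-y) =
  ≡-mod (∣-subst (identity u x y) (∣∧∣⇒*∣* p∣u p∣x-y))
  where identity : ∀ u x y → u * (x - y) ≡ u * x - u * y
        identity = solve-∀

-- Inverses modulo p and p²

record Invertible (m b : ℤ) : Set where
  constructor invertible
  field inverse : ℤ
        inverse-correct : b * inverse ≡ 1ℤ mod m

invertible-neg : ∀ {m b} → Invertible m b → Invertible m (- b)
invertible-neg {m} {b} (invertible c bc≡1) = invertible (- c) $ mod-trans (mod-reflexive (identity b c)) bc≡1
  where identity : ∀ b c → - b * - c ≡ b * c
        identity = solve-∀

-- Newton's iteration c ↦ c (2 - b c) squares the error term b c - 1.
invertible-mod-square : ∀ {m b} → Invertible m b → Invertible (m * m) b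
invertible-mod-square {m} {b} (invertible c (≡-mod (divides k bc-1≡km))) =
  invertible (c * (+ 2 - b * c)) $ ≡-mod (divides (- (k * k)) (begin
    b * (c * (+ 2 - b * c)) - 1ℤ          ≡⟨ identity b c ⟩
    - ((b * c - 1ℤ) * (b * c - 1ℤ))     ≡⟨ cong (λ z → - (z * z)) bc-1≡km ⟩
    - ((k * m) * (k * m))                 ≡⟨ identity′ k m ⟩
    - (k * k) * (m * m)                   ∎))
  where
    open ≡-Reasoning
    identity : ∀ b c → b * (c * (+ 2 - b * c)) - 1ℤ ≡ - ((b * c - 1ℤ) * (b * c - 1ℤ))
    identity = solve-∀
    identity′ : ∀ k m → - ((k * m) * (k * m)) ≡ - (k * k) * (m * m)
    identity′ = solve-∀

*-cancelˡ-mod : ∀ {m c a b} → Invertible m c → c * a ≡ c * b mod m → a ≡ b mod m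
*-cancelˡ-mod {m} {c} {a} {b} (invertible d cd≡1) ca≡cb = begin
  a            ≡⟨ ℤP.*-identityʳ a ⟨
  a * 1ℤ       ≈⟨ *-congˡ-mod a cd≡1 ⟨
  a * (c * d)  ≡⟨ reassociate a c d ⟩
  (c * a) * d  ≈⟨ *-congʳ-mod d ca≡cb ⟩
  (c * b) * d  ≡⟨ reassociate b c d ⟨
  b * (c * d)  ≈⟨ *-congˡ-mod b cd≡1 ⟩
  b * 1ℤ       ≡⟨ ℤP.*-identityʳ b ⟩
  b            ∎
  where open mod-Reasoning m
        reassociate : ∀ a c d → a * (c * d) ≡ (c * a) * d
        reassociate = solve-∀

∣-cancelˡ : ∀ {m c a} → Invertible m c → m ∣ c * a → m ∣ a
∣-cancelˡ {m} {c} {a} inv m∣ca =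
  mod-0⇒∣ (*-cancelˡ-mod inv (mod-trans (∣⇒mod-0 m∣ca) (mod-reflexive (sym (ℤP.*-zeroʳ c)))))

module ModPrime {p : ℕ} (prime : Prime p) where

  ∤⇒coprime : ∀ {n} → ¬ (p ℕD.∣ n) → Coprime p n
  ∤⇒coprime p∤n (d∣p , d∣n) with prime⇒irreducible prime d∣p
  ... | inj₁ d≡1 = d≡1
  ... | inj₂ refl = ⊥-elim (p∤n d∣n)

  private
    pos-bézout : ∀ u v s t → 1 ℕ.+ u ℕ.* v ≡ s ℕ.* t → 1ℤ + + u * + v ≡ + s * + t
    pos-bézout u v s t eq = begin
      1ℤ + + u * + v      ≡⟨ cong (λ z → 1ℤ + z) (ℤP.pos-* u v) ⟨
      + (1 ℕ.+ u ℕ.* v)   ≡⟨ cong +_ eq ⟩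
      + (s ℕ.* t)         ≡⟨ ℤP.pos-* s t ⟩
      + s * + t           ∎
      where open ≡-Reasoning

    invertible-pos : ∀ n → ¬ (p ℕD.∣ n) → Invertible (+ p) (+ n)
    invertible-pos n p∤n with coprime-Bézout (∤⇒coprime p∤n)
    ... | Bézout.+- x y eq = invertible (- (+ y)) $ ≡-mod (divides (- (+ x)) (begin
          + n * - (+ y) - 1ℤ    ≡⟨ identity (+ n) (+ y) ⟩
          - (1ℤ + + y * + n)    ≡⟨ cong -_ (pos-bézout y n x p eq) ⟩
          - (+ x * + p)         ≡⟨ ℤP.neg-distribˡ-* (+ x) (+ p) ⟩
          - (+ x) * + p         ∎))
      where open ≡-Reasoning
            identity : ∀ n y → n * - y - 1ℤ ≡ - (1ℤ + y * n)
            identity = solve-∀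
    ... | Bézout.-+ x y eq = invertible (+ y) $ ≡-mod (divides (+ x) (begin
          + n * + y - 1ℤ          ≡⟨ cong (_- 1ℤ) (ℤP.*-comm (+ n) (+ y)) ⟩
          + y * + n - 1ℤ          ≡⟨ cong (_- 1ℤ) (pos-bézout x p y n eq) ⟨
          (1ℤ + + x * + p) - 1ℤ   ≡⟨ identity (+ x * + p) ⟩
          + x * + p               ∎))
      where open ≡-Reasoning
            identity : ∀ z → (1ℤ + z) - 1ℤ ≡ z
            identity = solve-∀

  invertible-mod-prime : ∀ {b} → ¬ (+ p ∣ b) → Invertible (+ p) b
  invertible-mod-prime {+ n} p∤b = invertible-pos n (λ p∣n → p∤b (∣ᵤ⇒∣ p∣n))
  invertible-mod-prime { -[1+ n ]} p∤b =
    invertible-neg (invertible-pos (suc n) (λ p∣n → p∤b (∣ᵤ⇒∣ p∣n)))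

  invertible-mod-prime² : ∀ {b} → ¬ (+ p ∣ b) → Invertible (+ p * + p) b
  invertible-mod-prime² p∤b = invertible-mod-square (invertible-mod-prime p∤b)

  prime∤* : ∀ {a b} → ¬ (+ p ∣ a) → ¬ (+ p ∣ b) → ¬ (+ p ∣ a * b)
  prime∤* {a} {b} p∤a p∤b p∣ab
    with euclidsLemma ℤ.∣ a ∣ ℤ.∣ b ∣ prime (subst (p ℕD.∣_) (ℤP.abs-* a b) (∣⇒∣ᵤ p∣ab))
  ... | inj₁ p∣a = p∤a (∣ᵤ⇒∣ p∣a)
  ... | inj₂ p∣b = p∤b (∣ᵤ⇒∣ p∣b)

<⇒∤ : ∀ {p n} → 0 < n → n < p → ¬ (+ p ∣ + n)
<⇒∤ {p} {suc n} _ n<p p∣n = ℕP.<⇒≱ n<p (ℕD.∣⇒≤ (∣⇒∣ᵤ p∣n))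

module LargePrime {p : ℕ} (prime : Prime p) (7≤p : 7 ℕ.≤ p) where

  open ModPrime prime

  ∤-small : ∀ n .{{_ : ℕ.NonZero n}} {n<7 : True (n ℕ.<? 7)} → ¬ (+ p ∣ + n)
  ∤-small n {n<7} = <⇒∤ (ℕ.>-nonZero⁻¹ n) (ℕP.<-≤-trans (toWitness n<7) 7≤p)

  ∣-cancel-small : ∀ n .{{_ : ℕ.NonZero n}} {n<7 : True (n ℕ.<? 7)} {x} → + p ∣ + n * x → + p ∣ x
  ∣-cancel-small n {n<7} = ∣-cancelˡ (invertible-mod-prime (∤-small n {n<7}))

-- Finite sums

∑< : ℕ → (ℕ → ℤ) → ℤ
∑< zero f = 0ℤ
∑< (suc n) f = ∑< n f + f n

infix 5 ∑<
syntax ∑< n (λ i → e) = ∑[ i < n ] e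

∑-cong : ∀ n {f g : ℕ → ℤ} → (∀ i → i < n → f i ≡ g i) → ∑< n f ≡ ∑< n g
∑-cong zero f≡g = refl
∑-cong (suc n) f≡g = cong₂ _+_ (∑-cong n (λ i i<n → f≡g i (ℕP.m<n⇒m<1+n i<n))) (f≡g n ℕP.≤-refl)

∑-cong-mod : ∀ {m} n {f g : ℕ → ℤ} → (∀ i → i < n → f i ≡ g i mod m) → ∑< n f ≡ ∑< n g mod m
∑-cong-mod zero f≡g = mod-refl
∑-cong-mod (suc n) f≡g = +-cong-mod (∑-cong-mod n (λ i i<n → f≡g i (ℕP.m<n⇒m<1+n i<n))) (f≡g n ℕP.≤-refl)

∑-distrib-+ : ∀ n (f g : ℕ → ℤ) → ∑[ i < n ] (f i + g i) ≡ ∑< n f + ∑< n g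
∑-distrib-+ zero f g = refl
∑-distrib-+ (suc n) f g = trans (cong (_+ (f n + g n)) (∑-distrib-+ n f g)) (interchange (∑< n f) (∑< n g) (f n) (g n))
  where interchange : ∀ a b c d → a + b + (c + d) ≡ a + c + (b + d)
        interchange = solve-∀

*-distribˡ-∑ : ∀ n c (f : ℕ → ℤ) → ∑[ i < n ] c * f i ≡ c * ∑< n f
*-distribˡ-∑ zero c f = sym (ℤP.*-zeroʳ c)
*-distribˡ-∑ (suc n) c f =
  trans (cong (_+ c * f n) (*-distribˡ-∑ n c f)) (sym (ℤP.*-distribˡ-+ c (∑< n f) (f n)))

*-distribʳ-∑ : ∀ n c (f : ℕ → ℤ) → ∑[ i < n ] f i * c ≡ ∑< n f * c
*-distribʳ-∑ n c f = begin
  ∑[ i < n ] f i * c  ≡⟨ ∑-cong n (λ i _ → ℤP.*-comm (f i) c) ⟩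
  ∑[ i < n ] c * f i  ≡⟨ *-distribˡ-∑ n c f ⟩
  c * ∑< n f          ≡⟨ ℤP.*-comm c (∑< n f) ⟩
  ∑< n f * c          ∎
  where open ≡-Reasoning

neg-distrib-∑ : ∀ n (f : ℕ → ℤ) → ∑[ i < n ] - f i ≡ - ∑< n f
neg-distrib-∑ zero f = refl
neg-distrib-∑ (suc n) f =
  trans (cong (_+ - f n) (neg-distrib-∑ n f)) (sym (ℤP.neg-distrib-+ (∑< n f) (f n)))

∑-distrib-- : ∀ n (f g : ℕ → ℤ) → ∑[ i < n ] (f i - g i) ≡ ∑< n f - ∑< n g
∑-distrib-- n f g = trans (∑-distrib-+ n f (λ i → - g i)) (cong (λ z → ∑< n f + z) (neg-distrib-∑ n g))

∑-const : ∀ n c → ∑[ i < n ] c ≡ + n * c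
∑-const zero c = sym (ℤP.*-zeroˡ c)
∑-const (suc n) c = begin
  ∑< n (λ _ → c) + c  ≡⟨ cong (_+ c) (∑-const n c) ⟩
  + n * c + c         ≡⟨ identity (+ n) c ⟩
  (+ 1 + + n) * c     ≡⟨ cong (_* c) (ℤP.pos-+ 1 n) ⟨
  + suc n * c         ∎
  where open ≡-Reasoning
        identity : ∀ n c → n * c + c ≡ (+ 1 + n) * c
        identity = solve-∀

∑-suc : ∀ n (f : ℕ → ℤ) → ∑< (suc n) f ≡ f 0 + (∑[ i < n ] f (suc i))
∑-suc zero f = trans (ℤP.+-identityˡ (f 0)) (sym (ℤP.+-identityʳ (f 0)))
∑-suc (suc n) f = trans (cong (_+ f (suc n)) (∑-suc n f)) (ℤP.+-assoc (f 0) _ _)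

∑-reverse : ∀ n (f : ℕ → ℤ) → ∑< n f ≡ ∑[ i < n ] f (n ∸ suc i)
∑-reverse zero f = refl
∑-reverse (suc n) f = begin
  ∑< n f + f n                          ≡⟨ cong (_+ f n) (∑-reverse n f) ⟩
  (∑[ i < n ] f (n ∸ suc i)) + f n      ≡⟨ ℤP.+-comm _ (f n) ⟩
  f n + (∑[ i < n ] f (n ∸ suc i))      ≡⟨ ∑-suc n (λ i → f (suc n ∸ suc i)) ⟨
  ∑[ i < suc n ] f (suc n ∸ suc i)      ∎
  where open ≡-Reasoning

∑-split : ∀ a b (f : ℕ → ℤ) → ∑< (a ℕ.+ b) f ≡ ∑< a f + (∑[ i < b ] f (a ℕ.+ i))
∑-split zero b f = sym (ℤP.+-identityˡ _)
∑-split (suc a) b f = begin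
  ∑< (suc a ℕ.+ b) f
    ≡⟨ ∑-suc (a ℕ.+ b) f ⟩
  f 0 + (∑[ i < a ℕ.+ b ] f (suc i))
    ≡⟨ cong (λ z → f 0 + z) (∑-split a b (λ i → f (suc i))) ⟩
  f 0 + ((∑[ i < a ] f (suc i)) + (∑[ i < b ] f (suc a ℕ.+ i)))
    ≡⟨ ℤP.+-assoc (f 0) _ _ ⟨
  f 0 + (∑[ i < a ] f (suc i)) + (∑[ i < b ] f (suc a ℕ.+ i))
    ≡⟨ cong (_+ (∑[ i < b ] f (suc a ℕ.+ i))) (∑-suc a f) ⟨
  ∑< (suc a) f + (∑[ i < b ] f (suc a ℕ.+ i))
    ∎
  where open ≡-Reasoning

∑*∑ : ∀ a b (f g : ℕ → ℤ) → ∑< a f * ∑< b g ≡ ∑[ i < a ] ∑[ j < b ] f i * g j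
∑*∑ a b f g = trans (sym (*-distribʳ-∑ a (∑< b g) f)) (∑-cong a (λ i _ → sym (*-distribˡ-∑ b (f i) g)))

-- Sums over triangles

∸-∸-suc : ∀ M i j → (M ∸ i) ∸ suc j ≡ M ∸ suc (i ℕ.+ j)
∸-∸-suc M i j = trans (ℕP.∸-+-assoc M i (suc j)) (cong (M ∸_) (ℕP.+-suc i j))

<∸⇒suc+≤ : ∀ {M i j} → i ≤ M → j < M ∸ i → suc (i ℕ.+ j) ≤ M
<∸⇒suc+≤ {M} {i} {j} i≤M j<M∸i = begin
  suc (i ℕ.+ j)  ≡⟨ ℕP.+-suc i j ⟨
  i ℕ.+ suc j    ≤⟨ ℕP.+-monoʳ-≤ i j<M∸i ⟩
  i ℕ.+ (M ∸ i)  ≡⟨ ℕP.m+[n∸m]≡n i≤M ⟩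
  M              ∎
  where open ℕP.≤-Reasoning

private
  complement-of-suc+ : ∀ {M i j} → suc (i ℕ.+ j) ≤ M → M ∸ suc (i ℕ.+ ((M ∸ i) ∸ suc j)) ≡ j
  complement-of-suc+ {M} {i} {j} h rewrite ∸-∸-suc M i j with M ∸ suc (i ℕ.+ j) | ℕP.m+[n∸m]≡n h
  ... | r | refl = trans (cong (_∸ suc (i ℕ.+ r)) (identity i j r)) (ℕP.m+n∸m≡n (suc (i ℕ.+ r)) j)
    where identity : ∀ i j r → suc (i ℕ.+ j) ℕ.+ r ≡ suc (i ℕ.+ r) ℕ.+ j
          identity = solve-∀ℕ

  reflected-index : ∀ {M i j} → i ≤ M → j < M ∸ i → (M ∸ (M ∸ i)) ℕ.+ suc ((M ∸ i) ∸ suc j) ≡ M ∸ j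
  reflected-index {M} {i} {j} i≤M j<M∸i
    rewrite ℕP.m∸[m∸n]≡n i≤M | ∸-∸-suc M i j
    with M ∸ suc (i ℕ.+ j) | ℕP.m+[n∸m]≡n (<∸⇒suc+≤ i≤M j<M∸i)
  ... | r | refl = sym (trans (cong (_∸ j) (identity i j r)) (trans (ℕP.m+n∸m≡n j (suc (i ℕ.+ r))) (sym (ℕP.+-suc i r))))
    where identity : ∀ i j r → suc (i ℕ.+ j) ℕ.+ r ≡ j ℕ.+ suc (i ℕ.+ r)
          identity = solve-∀ℕ

∑-triangle-swap : ∀ M (G : ℕ → ℕ → ℤ) → ∑[ i < M ] ∑[ j < M ∸ i ] G i j ≡ ∑[ j < M ] ∑[ i < M ∸ j ] G i j
∑-triangle-swap zero G = refl
∑-triangle-swap (suc M) G = begin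
  ∑[ i < suc M ] ∑[ j < suc M ∸ i ] G i j
    ≡⟨ ∑-suc M _ ⟩
  (∑[ j < suc M ] G 0 j) + (∑[ i < M ] ∑[ j < M ∸ i ] G (suc i) j)
    ≡⟨ cong (λ z → (∑[ j < suc M ] G 0 j) + z) (∑-triangle-swap M (λ i j → G (suc i) j)) ⟩
  (∑[ j < suc M ] G 0 j) + (∑[ j < M ] ∑[ i < M ∸ j ] G (suc i) j)
    ≡⟨ cong (λ z → (∑[ j < suc M ] G 0 j) + z) last-row-empty ⟨
  (∑[ j < suc M ] G 0 j) + (∑[ j < suc M ] ∑[ i < M ∸ j ] G (suc i) j)
    ≡⟨ ∑-distrib-+ (suc M) _ _ ⟨
  ∑[ j < suc M ] (G 0 j + (∑[ i < M ∸ j ] G (suc i) j))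
    ≡⟨ ∑-cong (suc M) (λ j j≤M → trans (sym (∑-suc (M ∸ j) (λ i → G i j)))
                                         (cong (λ n → ∑< n (λ i → G i j)) (sym (ℕP.+-∸-assoc 1 (ℕP.≤-pred j≤M))))) ⟩
  ∑[ j < suc M ] ∑[ i < suc M ∸ j ] G i j
    ∎
  where
    open ≡-Reasoning
    last-row-empty : ∑[ j < suc M ] ∑[ i < M ∸ j ] G (suc i) j ≡ ∑[ j < M ] ∑[ i < M ∸ j ] G (suc i) j
    last-row-empty =
      trans (cong (λ n → (∑[ j < M ] ∑[ i < M ∸ j ] G (suc i) j) + ∑< n (λ i → G (suc i) M)) (ℕP.n∸n≡0 M))
            (ℤP.+-identityʳ _)

-- ∑△ M F sums F i j k over all i + j + k + 1 = M; it is opaque so that unification recovers F.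
opaque
  ∑△ : ℕ → (ℕ → ℕ → ℕ → ℤ) → ℤ
  ∑△ M F = ∑[ i < M ] ∑[ j < M ∸ i ] F i j (M ∸ suc (i ℕ.+ j))

opaque
  unfolding ∑△

  ∑△-cong : ∀ M {F G : ℕ → ℕ → ℕ → ℤ} → (∀ i j k → F i j k ≡ G i j k) → ∑△ M F ≡ ∑△ M G
  ∑△-cong M F≡G = ∑-cong M (λ i _ → ∑-cong (M ∸ i) (λ j _ → F≡G i j _))

  ∑△-cong-mod : ∀ {m} M {F G : ℕ → ℕ → ℕ → ℤ} →
                (∀ i j → suc (i ℕ.+ j) ≤ M → F i j (M ∸ suc (i ℕ.+ j)) ≡ G i j (M ∸ suc (i ℕ.+ j)) mod m) →
                ∑△ M F ≡ ∑△ M G mod m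
  ∑△-cong-mod M F≡G =
    ∑-cong-mod M (λ i i<M → ∑-cong-mod (M ∸ i) (λ j j< → F≡G i j (<∸⇒suc+≤ (ℕP.<⇒≤ i<M) j<)))

  ∑△-distrib-+ : ∀ M (F G : ℕ → ℕ → ℕ → ℤ) → ∑△ M (λ i j k → F i j k + G i j k) ≡ ∑△ M F + ∑△ M G
  ∑△-distrib-+ M F G = trans (∑-cong M (λ i _ → ∑-distrib-+ (M ∸ i) _ _)) (∑-distrib-+ M _ _)

  *-distribˡ-∑△ : ∀ M c (F : ℕ → ℕ → ℕ → ℤ) → ∑△ M (λ i j k → c * F i j k) ≡ c * ∑△ M F
  *-distribˡ-∑△ M c F = trans (∑-cong M (λ i _ → *-distribˡ-∑ (M ∸ i) c _)) (*-distribˡ-∑ M c _)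

  ∑△-swap₁₂ : ∀ M F → ∑△ M F ≡ ∑△ M (λ i j k → F j i k)
  ∑△-swap₁₂ M F = trans (∑-triangle-swap M (λ i j → F i j (M ∸ suc (i ℕ.+ j))))
    (∑-cong M (λ j _ → ∑-cong (M ∸ j) (λ i _ → cong (λ n → F i j (M ∸ suc n)) (ℕP.+-comm i j))))

  ∑△-swap₂₃ : ∀ M F → ∑△ M F ≡ ∑△ M (λ i j k → F i k j)
  ∑△-swap₂₃ M F = ∑-cong M (λ i i<M → trans (∑-reverse (M ∸ i) _)
    (∑-cong (M ∸ i) (λ j j< → cong₂ (F i) (∸-∸-suc M i j) (complement-of-suc+ (<∸⇒suc+≤ (ℕP.<⇒≤ i<M) j<)))))

  ∑-below-antidiagonal : ∀ M (G : ℕ → ℕ → ℤ) → ∑[ i < suc M ] ∑[ j < M ∸ i ] G i j ≡ ∑△ M (λ i j _ → G i j)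
  ∑-below-antidiagonal M G = trans (cong (λ n → (∑[ i < M ] ∑[ j < M ∸ i ] G i j) + ∑< n (G M)) (ℕP.n∸n≡0 M))
                                   (ℤP.+-identityʳ _)

-- The triangle above the antidiagonal of [0, M]² is the reflection (i , j) ↦ (M - i , M - j)
-- of the one below it.
∑-square-split : ∀ M (G : ℕ → ℕ → ℤ) →
  ∑[ i < suc M ] ∑[ j < suc M ] G i j
  ≡ ∑△ M (λ i j _ → G i j) + (∑[ i < suc M ] G i (M ∸ i)) + ∑△ M (λ i j _ → G (M ∸ i) (M ∸ j))
∑-square-split M G = begin
  ∑[ i < suc M ] ∑[ j < suc M ] G i j
    ≡⟨ ∑-cong (suc M) split-row ⟩
  ∑[ i < suc M ] (Below i + (Diagonal i + Above i))
    ≡⟨ trans (∑-distrib-+ (suc M) Below _) (cong (λ z → ∑< (suc M) Below + z) (∑-distrib-+ (suc M) Diagonal Above)) ⟩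
  ∑< (suc M) Below + (∑< (suc M) Diagonal + ∑< (suc M) Above)
    ≡⟨ ℤP.+-assoc (∑< (suc M) Below) _ _ ⟨
  ∑< (suc M) Below + ∑< (suc M) Diagonal + ∑< (suc M) Above
    ≡⟨ cong₂ (λ x y → x + ∑< (suc M) Diagonal + y) (∑-below-antidiagonal M G) reflect-above ⟩
  ∑△ M (λ i j _ → G i j) + ∑< (suc M) Diagonal + ∑△ M (λ i j _ → G (M ∸ i) (M ∸ j))
    ∎
  where
    open ≡-Reasoning
    Below Diagonal Above : ℕ → ℤ
    Below i = ∑[ j < M ∸ i ] G i j
    Diagonal i = G i (M ∸ i)
    Above i = ∑[ j < i ] G i ((M ∸ i) ℕ.+ suc j)

    split-row : ∀ i → i < suc M → ∑< (suc M) (G i) ≡ Below i + (Diagonal i + Above i)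
    split-row i i≤M = begin
      ∑< (suc M) (G i)                                ≡⟨ cong (λ n → ∑< n (G i)) row-length ⟨
      ∑< ((M ∸ i) ℕ.+ suc i) (G i)                    ≡⟨ ∑-split (M ∸ i) (suc i) (G i) ⟩
      Below i + (∑[ j < suc i ] G i ((M ∸ i) ℕ.+ j))  ≡⟨ cong (λ z → Below i + z) (∑-suc i _) ⟩
      Below i + (G i ((M ∸ i) ℕ.+ 0) + Above i)       ≡⟨ cong (λ n → Below i + (G i n + Above i)) (ℕP.+-identityʳ (M ∸ i)) ⟩
      Below i + (Diagonal i + Above i)                ∎
      where row-length : (M ∸ i) ℕ.+ suc i ≡ suc M
            row-length = trans (ℕP.+-suc (M ∸ i) i) (cong suc (ℕP.m∸n+n≡m (ℕP.≤-pred i≤M)))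

    reflect-above : ∑< (suc M) Above ≡ ∑△ M (λ i j _ → G (M ∸ i) (M ∸ j))
    reflect-above = trans (∑-reverse (suc M) Above) (trans (∑-cong (suc M) (λ i i≤M →
      trans (∑-reverse (M ∸ i) _) (∑-cong (M ∸ i) (λ j j< →
        cong (G (M ∸ i)) (reflected-index (ℕP.≤-pred i≤M) j<))))) (∑-below-antidiagonal M _))

-- Lucas sequences

module LucasIdentities (P Q : ℤ) where

  D : ℤ
  D = P * P - + 4 * Q

  V≡2U-PU : ∀ n → V P Q n ≡ + 2 * U P Q (suc n) - P * U P Q n
  V≡2U-PU zero = identity P
    where identity : ∀ P → + 2 ≡ + 2 * + 1 - P * + 0
          identity = solve-∀
  V≡2U-PU (suc zero) = identity P Q
    where identity : ∀ P Q → P ≡ + 2 * (P * + 1 - Q * + 0) - P * + 1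
          identity = solve-∀
  V≡2U-PU (suc (suc n)) =
    trans (cong₂ (λ a b → P * a - Q * b) (V≡2U-PU (suc n)) (V≡2U-PU n)) (identity P Q (U P Q n) (U P Q (suc n)))
    where identity : ∀ P Q a b → P * (+ 2 * (P * b - Q * a) - P * b) - Q * (+ 2 * b - P * a)
                                 ≡ + 2 * (P * (P * b - Q * a) - Q * b) - P * (P * b - Q * a)
          identity = solve-∀

  cassini : ∀ n → U P Q (suc n) * U P Q (suc n) - P * U P Q (suc n) * U P Q n + Q * U P Q n * U P Q n ≡ Q ^ n
  cassini zero = identity P Q
    where identity : ∀ P Q → + 1 * + 1 - P * + 1 * + 0 + Q * + 0 * + 0 ≡ + 1
          identity = solve-∀
  cassini (suc n) = trans (identity P Q (U P Q n) (U P Q (suc n))) (cong (Q *_) (cassini n))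
    where identity : ∀ P Q a b → (P * b - Q * a) * (P * b - Q * a) - P * (P * b - Q * a) * b + Q * b * b
                                 ≡ Q * (b * b - P * b * a + Q * a * a)
          identity = solve-∀

  V²-DU² : ∀ n → V P Q n * V P Q n - D * U P Q n * U P Q n ≡ + 4 * Q ^ n
  V²-DU² n = trans (cong (λ z → z * z - D * U P Q n * U P Q n) (V≡2U-PU n))
                   (trans (identity P Q (U P Q n) (U P Q (suc n))) (cong (+ 4 *_) (cassini n)))
    where identity : ∀ P Q a b → (+ 2 * b - P * a) * (+ 2 * b - P * a) - (P * P - + 4 * Q) * a * a
                                 ≡ + 4 * (b * b - P * b * a + Q * a * a)
          identity = solve-∀

  U-addition : ∀ m n → + 2 * U P Q (m ℕ.+ n) ≡ U P Q m * V P Q n + U P Q n * V P Q m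
  U-addition zero n = identity (U P Q n) (V P Q n)
    where identity : ∀ a b → + 2 * a ≡ + 0 * b + a * + 2
          identity = solve-∀
  U-addition (suc zero) n =
    trans (identity (U P Q (suc n)) (U P Q n) P) (cong (λ z → + 1 * z + U P Q n * P) (sym (V≡2U-PU n)))
    where identity : ∀ b a P → + 2 * b ≡ + 1 * (+ 2 * b - P * a) + a * P
          identity = solve-∀
  U-addition (suc (suc m)) n =
    trans (identity P Q (U P Q (suc m ℕ.+ n)) (U P Q (m ℕ.+ n)))
      (trans (cong₂ (λ a b → P * a - Q * b) (U-addition (suc m) n) (U-addition m n))
        (identity′ P Q (U P Q (suc m)) (U P Q m) (V P Q (suc m)) (V P Q m) (U P Q n) (V P Q n)))
    where identity : ∀ P Q a b → + 2 * (P * a - Q * b) ≡ P * (+ 2 * a) - Q * (+ 2 * b)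
          identity = solve-∀
          identity′ : ∀ P Q u₁ u₀ v₁ v₀ u v → P * (u₁ * v + u * v₁) - Q * (u₀ * v + u * v₀)
                                              ≡ (P * u₁ - Q * u₀) * v + u * (P * v₁ - Q * v₀)
          identity′ = solve-∀

  V-addition : ∀ m n → + 2 * V P Q (m ℕ.+ n) ≡ V P Q m * V P Q n + D * U P Q m * U P Q n
  V-addition zero n = identity (V P Q n) D (U P Q n)
    where identity : ∀ a d u → + 2 * a ≡ + 2 * a + d * + 0 * u
          identity = solve-∀
  V-addition (suc zero) n =
    trans (cong (+ 2 *_) (V≡2U-PU (suc n)))
      (trans (identity P Q (U P Q n) (U P Q (suc n))) (cong (λ z → z + D * + 1 * U P Q n) (sym (cong (P *_) (V≡2U-PU n)))))
    where identity : ∀ P Q a b → + 2 * (+ 2 * (P * b - Q * a) - P * b) ≡ P * (+ 2 * b - P * a) + (P * P - + 4 * Q) * + 1 * a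
          identity = solve-∀
  V-addition (suc (suc m)) n =
    trans (identity P Q (V P Q (suc m ℕ.+ n)) (V P Q (m ℕ.+ n)))
      (trans (cong₂ (λ a b → P * a - Q * b) (V-addition (suc m) n) (V-addition m n))
        (identity′ P Q D (U P Q (suc m)) (U P Q m) (V P Q (suc m)) (V P Q m) (U P Q n) (V P Q n)))
    where identity : ∀ P Q a b → + 2 * (P * a - Q * b) ≡ P * (+ 2 * a) - Q * (+ 2 * b)
          identity = solve-∀
          identity′ : ∀ P Q D u₁ u₀ v₁ v₀ u v → P * (v₁ * v + D * u₁ * u) - Q * (v₀ * v + D * u₀ * u)
                                                ≡ (P * v₁ - Q * v₀) * v + D * (P * u₁ - Q * u₀) * u
          identity′ = solve-∀

  -- The relation w (a + b) (w a + w b) = w a w b + D between the quotients w n = V n / U n,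
  -- with denominators cleared.
  addition-law : ∀ a b → V P Q a * V P Q b * U P Q (a ℕ.+ b) - V P Q (a ℕ.+ b) * (U P Q a * V P Q b + U P Q b * V P Q a)
                         + D * U P Q a * U P Q b * U P Q (a ℕ.+ b) ≡ 0ℤ
  addition-law a b = ℤP.*-cancelˡ-≡ (+ 2) _ 0ℤ (begin
    + 2 * (Va * Vb * Un - Vn * σ + D * Ua * Ub * Un)          ≡⟨ identity Va Vb Un Vn σ D Ua Ub ⟩
    Va * Vb * (+ 2 * Un) - (+ 2 * Vn) * σ + D * Ua * Ub * (+ 2 * Un)
      ≡⟨ cong₂ (λ x y → Va * Vb * x - y * σ + D * Ua * Ub * x) (U-addition a b) (V-addition a b) ⟩
    Va * Vb * σ - (Va * Vb + D * Ua * Ub) * σ + D * Ua * Ub * σ ≡⟨ identity′ Va Vb σ D Ua Ub ⟩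
    + 2 * 0ℤ                                                  ∎)
    where
      open ≡-Reasoning
      Ua Ub Va Vb Un Vn σ : ℤ
      Ua = U P Q a
      Ub = U P Q b
      Va = V P Q a
      Vb = V P Q b
      Un = U P Q (a ℕ.+ b)
      Vn = V P Q (a ℕ.+ b)
      σ = Ua * Vb + Ub * Va
      identity : ∀ Va Vb Un Vn σ D Ua Ub → + 2 * (Va * Vb * Un - Vn * σ + D * Ua * Ub * Un)
                   ≡ Va * Vb * (+ 2 * Un) - (+ 2 * Vn) * σ + D * Ua * Ub * (+ 2 * Un)
      identity = solve-∀
      identity′ : ∀ Va Vb σ D Ua Ub → Va * Vb * σ - (Va * Vb + D * Ua * Ub) * σ + D * Ua * Ub * σ ≡ + 2 * 0ℤ
      identity′ = solve-∀

-- Newton's identities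

module NewtonIdentities (A : ℕ → ℤ) where

  e₁ e₂ e₃ e₄ s₁ s₂ s₃ s₄ : ℕ → ℤ
  e₁ n = ∑[ i < n ] A i
  e₂ n = ∑[ i < n ] e₁ i * A i
  e₃ n = ∑[ i < n ] e₂ i * A i
  e₄ n = ∑[ i < n ] e₃ i * A i
  s₁ n = ∑[ i < n ] A i
  s₂ n = ∑[ i < n ] A i * A i
  s₃ n = ∑[ i < n ] A i * A i * A i
  s₄ n = ∑[ i < n ] A i * A i * A i * A i

  newton₂ : ∀ n → + 2 * e₂ n ≡ s₁ n * s₁ n - s₂ n
  newton₂ zero = refl
  newton₂ (suc n) = trans (identity (e₂ n) (s₁ n) (A n))
    (trans (cong (λ z → z + + 2 * s₁ n * A n) (newton₂ n)) (identity′ (s₁ n) (s₂ n) (A n)))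
    where identity : ∀ e s a → + 2 * (e + s * a) ≡ + 2 * e + + 2 * s * a
          identity = solve-∀
          identity′ : ∀ s₁ s₂ a → s₁ * s₁ - s₂ + + 2 * s₁ * a ≡ (s₁ + a) * (s₁ + a) - (s₂ + a * a)
          identity′ = solve-∀

  newton₃ : ∀ n → + 6 * e₃ n ≡ s₁ n * s₁ n * s₁ n - + 3 * s₁ n * s₂ n + + 2 * s₃ n
  newton₃ zero = refl
  newton₃ (suc n) = trans (identity (e₃ n) (e₂ n) (A n))
    (trans (cong₂ (λ x y → x + + 3 * y * A n) (newton₃ n) (newton₂ n)) (identity′ (s₁ n) (s₂ n) (s₃ n) (A n)))
    where identity : ∀ e f a → + 6 * (e + f * a) ≡ + 6 * e + + 3 * (+ 2 * f) * a
          identity = solve-∀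
          identity′ : ∀ s₁ s₂ s₃ a → s₁ * s₁ * s₁ - + 3 * s₁ * s₂ + + 2 * s₃ + + 3 * (s₁ * s₁ - s₂) * a
                       ≡ (s₁ + a) * (s₁ + a) * (s₁ + a) - + 3 * (s₁ + a) * (s₂ + a * a) + + 2 * (s₃ + a * a * a)
          identity′ = solve-∀

  newton₄ : ∀ n → + 24 * e₄ n ≡ s₁ n * s₁ n * s₁ n * s₁ n - + 6 * s₁ n * s₁ n * s₂ n + + 3 * s₂ n * s₂ n
                                + + 8 * s₁ n * s₃ n - + 6 * s₄ n
  newton₄ zero = refl
  newton₄ (suc n) = trans (identity (e₄ n) (e₃ n) (A n))
    (trans (cong₂ (λ x y → x + + 4 * y * A n) (newton₄ n) (newton₃ n)) (identity′ (s₁ n) (s₂ n) (s₃ n) (s₄ n) (A n)))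
    where identity : ∀ e f a → + 24 * (e + f * a) ≡ + 24 * e + + 4 * (+ 6 * f) * a
          identity = solve-∀
          identity′ : ∀ s₁ s₂ s₃ s₄ a →
                        s₁ * s₁ * s₁ * s₁ - + 6 * s₁ * s₁ * s₂ + + 3 * s₂ * s₂ + + 8 * s₁ * s₃ - + 6 * s₄
                          + + 4 * (s₁ * s₁ * s₁ - + 3 * s₁ * s₂ + + 2 * s₃) * a
                        ≡ (s₁ + a) * (s₁ + a) * (s₁ + a) * (s₁ + a) - + 6 * (s₁ + a) * (s₁ + a) * (s₂ + a * a)
                          + + 3 * (s₂ + a * a) * (s₂ + a * a) + + 8 * (s₁ + a) * (s₃ + a * a * a) - + 6 * (s₄ + a * a * a * a)
          identity′ = solve-∀

  e₃-expanded : ∀ n → ∑[ i < n ] ∑[ j < i ] ∑[ k < j ] A k * A j * A i ≡ e₃ n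
  e₃-expanded n = ∑-cong n (λ i _ → trans
    (∑-cong i (λ j _ → trans (*-distribʳ-∑ j (A i) (λ k → A k * A j)) (cong (_* A i) (*-distribʳ-∑ j (A j) A))))
    (*-distribʳ-∑ i (A i) (λ j → e₁ j * A j)))

  e₄-expanded : ∀ n → ∑[ i < n ] ∑[ j < i ] ∑[ k < j ] ∑[ l < k ] A l * A k * A j * A i ≡ e₄ n
  e₄-expanded n = ∑-cong n (λ i _ → trans (sym (*-distribʳ-∑³ i (A i))) (cong (_* A i) (e₃-expanded i)))
    where
      *-distribʳ-∑³ : ∀ i a → (∑[ j < i ] ∑[ k < j ] ∑[ l < k ] A l * A k * A j) * a
                             ≡ ∑[ j < i ] ∑[ k < j ] ∑[ l < k ] A l * A k * A j * a
      *-distribʳ-∑³ i a = trans (sym (*-distribʳ-∑ i a _)) (∑-cong i (λ j _ →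
        trans (sym (*-distribʳ-∑ j a _)) (∑-cong j (λ k _ → sym (*-distribʳ-∑ k a _)))))

-- Power sums of a reflective family modulo p

module ReflectiveFamily
  {p : ℕ} (prime : Prime p) (p∤2 : ¬ (+ p ∣ + 2)) (D : ℤ) (M : ℕ) (A : ℕ → ℤ)
  (reflection : ∀ i → i ≤ M → A (M ∸ i) ≡ - A i mod + p)
  (triple : ∀ i j → suc (i ℕ.+ j) ≤ M →
            A i * A j + A j * A (M ∸ suc (i ℕ.+ j)) + A (M ∸ suc (i ℕ.+ j)) * A i + D ≡ 0ℤ mod + p)
  where

  open NewtonIdentities A
  open ModPrime prime

  m : ℤ
  m = + p

  L : ℕ
  L = suc M

  -- L as an integer, in the form the ring solver can relate to M.
  ℓ : ℤ
  ℓ = 1ℤ + + M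

  ℓ≡L : ℓ ≡ + L
  ℓ≡L = sym (ℤP.pos-+ 1 M)

  ∑-antisymmetric : ∀ (g : ℕ → ℤ) → (∀ i → i ≤ M → g (M ∸ i) ≡ - g i mod m) → m ∣ ∑< L g
  ∑-antisymmetric g g-odd = ∣-cancelˡ (invertible-mod-prime p∤2) (mod-0⇒∣ (begin
    + 2 * total                     ≡⟨ twice total ⟩
    total + total                   ≡⟨ cong (λ z → total + z) (∑-reverse L g) ⟩
    total + (∑[ i < L ] g (M ∸ i))  ≈⟨ +-congˡ-mod total (∑-cong-mod L (λ i i<L → g-odd i (ℕP.≤-pred i<L))) ⟩
    total + (∑[ i < L ] - g i)      ≡⟨ cong (λ z → total + z) (neg-distrib-∑ L g) ⟩
    total + - total                 ≡⟨ ℤP.+-inverseʳ total ⟩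
    0ℤ                              ∎))
    where open mod-Reasoning m
          total : ℤ
          total = ∑< L g
          twice : ∀ x → + 2 * x ≡ x + x
          twice = solve-∀

  s₁-vanishes : m ∣ s₁ L
  s₁-vanishes = ∑-antisymmetric A reflection

  s₃-vanishes : m ∣ s₃ L
  s₃-vanishes = ∑-antisymmetric (λ i → A i * A i * A i) (λ i i≤M →
    let r = reflection i i≤M in mod-trans (*-cong-mod (*-cong-mod r r) r) (mod-reflexive (odd (A i))))
    where odd : ∀ a → - a * - a * - a ≡ - (a * a * a)
          odd = solve-∀

  ∑-square-even : ∀ (G : ℕ → ℕ → ℤ) → (∀ i j → i ≤ M → j ≤ M → G (M ∸ i) (M ∸ j) ≡ G i j mod m) →
    ∑[ i < L ] ∑[ j < L ] G i j ≡ + 2 * ∑△ M (λ i j _ → G i j) + (∑[ i < L ] G i (M ∸ i)) mod m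
  ∑-square-even G G-even = begin
    ∑[ i < L ] ∑[ j < L ] G i j
      ≡⟨ ∑-square-split M G ⟩
    T + Δ + ∑△ M (λ i j _ → G (M ∸ i) (M ∸ j))
      ≈⟨ +-congˡ-mod (T + Δ) (∑△-cong-mod M (λ i j h →
           G-even i j (ℕP.≤-trans (ℕP.m≤m+n i j) (ℕP.<⇒≤ h)) (ℕP.≤-trans (ℕP.m≤n+m j i) (ℕP.<⇒≤ h)))) ⟩
    T + Δ + T
      ≡⟨ identity T Δ ⟩
    + 2 * T + Δ
      ∎
    where open mod-Reasoning m
          T Δ : ℤ
          T = ∑△ M (λ i j _ → G i j)
          Δ = ∑[ i < L ] G i (M ∸ i)
          identity : ∀ T Δ → T + Δ + T ≡ + 2 * T + Δ
          identity = solve-∀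

  ∑△-triple : ∀ (w : ℕ → ℕ → ℕ → ℤ) →
              ∑△ M (λ i j k → w i j k * (A i * A j + A j * A k + A k * A i + D)) ≡ 0ℤ mod m
  ∑△-triple w = begin
    ∑△ M W
      ≈⟨ ∑△-cong-mod M (λ i j h → *-congˡ-mod (w i j _) (triple i j h)) ⟩
    ∑△ M (λ i j k → w i j k * 0ℤ)
      ≡⟨ ∑△-cong M (λ i j k → ℤP.*-zeroʳ (w i j k)) ⟩
    ∑△ M (λ _ _ _ → 0ℤ * 0ℤ)
      ≡⟨ *-distribˡ-∑△ M 0ℤ (λ _ _ _ → 0ℤ) ⟩
    0ℤ
      ∎
    where open mod-Reasoning m
          W : ℕ → ℕ → ℕ → ℤ
          W = λ i j k → w i j k * (A i * A j + A j * A k + A k * A i + D)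

  -- Triangle sums of monomials: the subscripts are the exponents of A i, A j, A k.
  t₀ t₂ t₁₁ t₃₁ t₂₂ t₂₁₁ : ℤ
  t₀ = ∑△ M (λ _ _ _ → 1ℤ)
  t₂ = ∑△ M (λ i _ _ → A i * A i)
  t₁₁ = ∑△ M (λ i j _ → A i * A j)
  t₃₁ = ∑△ M (λ i j _ → A i * A i * A i * A j)
  t₂₂ = ∑△ M (λ i j _ → A i * A i * A j * A j)
  t₂₁₁ = ∑△ M (λ i j k → A i * A i * A j * A k)

  private
    ∑△-distrib-+₄ : ∀ (a b c d : ℕ → ℕ → ℕ → ℤ) →
      ∑△ M (λ i j k → a i j k + b i j k + c i j k + d i j k) ≡ ∑△ M a + ∑△ M b + ∑△ M c + ∑△ M d
    ∑△-distrib-+₄ a b c d = trans (∑△-distrib-+ M _ d)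
      (cong (_+ ∑△ M d) (trans (∑△-distrib-+ M _ c) (cong (_+ ∑△ M c) (∑△-distrib-+ M a b))))

    ∑△-const : ∀ c → ∑△ M (λ _ _ _ → c) ≡ c * t₀
    ∑△-const c = trans (∑△-cong M (λ _ _ _ → sym (ℤP.*-identityʳ c))) (*-distribˡ-∑△ M c _)

    ∑△-triple-expanded : ∀ w (a b c d : ℕ → ℕ → ℕ → ℤ) →
      (∀ i j k → w i j k * (A i * A j + A j * A k + A k * A i + D) ≡ a i j k + b i j k + c i j k + d i j k) →
      ∑△ M a + ∑△ M b + ∑△ M c + ∑△ M d ≡ 0ℤ mod m
    ∑△-triple-expanded w a b c d expand =
      mod-trans (mod-reflexive (sym (trans (∑△-cong M expand) (∑△-distrib-+₄ a b c d)))) (∑△-triple w)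

  triple-relation₀ : + 3 * t₁₁ + D * t₀ ≡ 0ℤ mod m
  triple-relation₀ = mod-trans (mod-reflexive (sym (begin
      t₁₁ + ∑△ M (λ i j k → A j * A k) + ∑△ M (λ i j k → A k * A i) + ∑△ M (λ _ _ _ → D)
        ≡⟨ cong (λ z → t₁₁ + ∑△ M (λ i j k → A j * A k) + ∑△ M (λ i j k → A k * A i) + z) (∑△-const D) ⟩
      t₁₁ + ∑△ M (λ i j k → A j * A k) + ∑△ M (λ i j k → A k * A i) + D * t₀
        ≡⟨ cong₂ (λ x y → t₁₁ + x + y + D * t₀)
             (trans (∑△-swap₁₂ M _) (∑△-swap₂₃ M _))
             (trans (∑△-cong M (λ i j k → ℤP.*-comm (A k) (A i))) (∑△-swap₂₃ M _)) ⟩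
      t₁₁ + t₁₁ + t₁₁ + D * t₀
        ≡⟨ identity t₁₁ (D * t₀) ⟩
      + 3 * t₁₁ + D * t₀
        ∎)))
    (∑△-triple-expanded (λ _ _ _ → 1ℤ)
      (λ i j _ → A i * A j) (λ i j k → A j * A k) (λ i j k → A k * A i) (λ _ _ _ → D)
      (λ i j k → expansion (A i) (A j) (A k) D))
    where
      open ≡-Reasoning
      identity : ∀ t e → t + t + t + e ≡ + 3 * t + e
      identity = solve-∀
      expansion : ∀ a b c D → 1ℤ * (a * b + b * c + c * a + D) ≡ a * b + b * c + c * a + D
      expansion = solve-∀

  triple-relation₂ : + 2 * t₃₁ + t₂₁₁ + D * t₂ ≡ 0ℤ mod m
  triple-relation₂ = mod-trans (mod-reflexive (sym (begin
      t₃₁ + t₂₁₁ + ∑△ M (λ i j k → A i * A i * A i * A k) + ∑△ M (λ i j k → D * (A i * A i))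
        ≡⟨ cong₂ (λ x y → t₃₁ + t₂₁₁ + x + y) (sym (∑△-swap₂₃ M _)) (*-distribˡ-∑△ M D _) ⟩
      t₃₁ + t₂₁₁ + t₃₁ + D * t₂
        ≡⟨ identity t₃₁ t₂₁₁ (D * t₂) ⟩
      + 2 * t₃₁ + t₂₁₁ + D * t₂
        ∎)))
    (∑△-triple-expanded (λ i _ _ → A i * A i)
      (λ i j _ → A i * A i * A i * A j) (λ i j k → A i * A i * A j * A k)
      (λ i j k → A i * A i * A i * A k) (λ i j k → D * (A i * A i))
      (λ i j k → expansion (A i) (A j) (A k) D))
    where
      open ≡-Reasoning
      identity : ∀ y w e → y + w + y + e ≡ + 2 * y + w + e
      identity = solve-∀
      expansion : ∀ a b c D → a * a * (a * b + b * c + c * a + D) ≡ a * a * a * b + a * a * b * c + a * a * a * c + D * (a * a)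
      expansion = solve-∀

  triple-relation₁₁ : t₂₂ + + 2 * t₂₁₁ + D * t₁₁ ≡ 0ℤ mod m
  triple-relation₁₁ = mod-trans (mod-reflexive (sym (begin
      t₂₂ + ∑△ M (λ i j k → A i * A j * A j * A k) + t₂₁₁ + ∑△ M (λ i j k → D * (A i * A j))
        ≡⟨ cong₂ (λ x y → t₂₂ + x + t₂₁₁ + y)
             (trans (∑△-swap₁₂ M _) (∑△-cong M (λ i j k → commute (A i) (A j) (A k)))) (*-distribˡ-∑△ M D _) ⟩
      t₂₂ + t₂₁₁ + t₂₁₁ + D * t₁₁
        ≡⟨ identity t₂₂ t₂₁₁ (D * t₁₁) ⟩
      t₂₂ + + 2 * t₂₁₁ + D * t₁₁
        ∎)))
    (∑△-triple-expanded (λ i j _ → A i * A j)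
      (λ i j _ → A i * A i * A j * A j) (λ i j k → A i * A j * A j * A k)
      (λ i j k → A i * A i * A j * A k) (λ i j k → D * (A i * A j))
      (λ i j k → expansion (A i) (A j) (A k) D))
    where
      open ≡-Reasoning
      identity : ∀ z w e → z + w + w + e ≡ z + + 2 * w + e
      identity = solve-∀
      commute : ∀ a b c → b * a * a * c ≡ a * a * b * c
      commute = solve-∀
      expansion : ∀ a b c D → a * b * (a * b + b * c + c * a + D) ≡ a * a * b * b + a * b * b * c + a * a * b * c + D * (a * b)
      expansion = solve-∀

  ∑*∑-even : ∀ (f g : ℕ → ℤ) → (∀ i j → i ≤ M → j ≤ M → f (M ∸ i) * g (M ∸ j) ≡ f i * g j mod m) →
    ∑< L f * ∑< L g ≡ + 2 * ∑△ M (λ i j _ → f i * g j) + (∑[ i < L ] f i * g (M ∸ i)) mod m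
  ∑*∑-even f g even = mod-trans (mod-reflexive (∑*∑ L L f g)) (∑-square-even (λ i j → f i * g j) even)

  private
    reflect : ∀ {i} → i < L → A (M ∸ i) ≡ - A i mod m
    reflect i<L = reflection _ (ℕP.≤-pred i<L)

  square₁₁ : s₁ L * s₁ L ≡ + 2 * t₁₁ - s₂ L mod m
  square₁₁ = begin
    s₁ L * s₁ L
      ≈⟨ ∑*∑-even A A (λ i j i≤M j≤M →
           mod-trans (*-cong-mod (reflection i i≤M) (reflection j j≤M)) (mod-reflexive (sign² (A i) (A j)))) ⟩
    + 2 * t₁₁ + (∑[ i < L ] A i * A (M ∸ i))
      ≈⟨ +-congˡ-mod (+ 2 * t₁₁) (∑-cong-mod L (λ i i<L → *-congˡ-mod (A i) (reflect i<L))) ⟩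
    + 2 * t₁₁ + (∑[ i < L ] A i * - A i)
      ≡⟨ cong (λ z → + 2 * t₁₁ + z) (trans (∑-cong L (λ i _ → sym (ℤP.neg-distribʳ-* (A i) (A i)))) (neg-distrib-∑ L _)) ⟩
    + 2 * t₁₁ - s₂ L
      ∎
    where open mod-Reasoning m
          sign² : ∀ a b → - a * - b ≡ a * b
          sign² = solve-∀

  square₃₁ : s₃ L * s₁ L ≡ + 2 * t₃₁ - s₄ L mod m
  square₃₁ = begin
    s₃ L * s₁ L
      ≈⟨ ∑*∑-even (λ i → A i * A i * A i) A (λ i j i≤M j≤M → let rᵢ = reflection i i≤M in
           mod-trans (*-cong-mod (*-cong-mod (*-cong-mod rᵢ rᵢ) rᵢ) (reflection j j≤M)) (mod-reflexive (sign⁴ (A i) (A j)))) ⟩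
    + 2 * t₃₁ + (∑[ i < L ] A i * A i * A i * A (M ∸ i))
      ≈⟨ +-congˡ-mod (+ 2 * t₃₁) (∑-cong-mod L (λ i i<L → *-congˡ-mod (A i * A i * A i) (reflect i<L))) ⟩
    + 2 * t₃₁ + (∑[ i < L ] A i * A i * A i * - A i)
      ≡⟨ cong (λ z → + 2 * t₃₁ + z) (trans (∑-cong L (λ i _ → sign³ (A i))) (neg-distrib-∑ L _)) ⟩
    + 2 * t₃₁ - s₄ L
      ∎
    where open mod-Reasoning m
          sign⁴ : ∀ a b → - a * - a * - a * - b ≡ a * a * a * b
          sign⁴ = solve-∀
          sign³ : ∀ a → a * a * a * - a ≡ - (a * a * a * a)
          sign³ = solve-∀

  square₂₂ : s₂ L * s₂ L ≡ + 2 * t₂₂ + s₄ L mod m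
  square₂₂ = begin
    s₂ L * s₂ L
      ≈⟨ ∑*∑-even (λ i → A i * A i) (λ i → A i * A i) (λ i j i≤M j≤M →
           let rᵢ = reflection i i≤M ; rⱼ = reflection j j≤M in
           mod-trans (*-cong-mod (*-cong-mod rᵢ rᵢ) (*-cong-mod rⱼ rⱼ)) (mod-reflexive (sign⁴ (A i) (A j)))) ⟩
    + 2 * ∑△ M (λ i j _ → A i * A i * (A j * A j)) + (∑[ i < L ] A i * A i * (A (M ∸ i) * A (M ∸ i)))
      ≈⟨ +-cong-mod (mod-reflexive (cong (+ 2 *_) (∑△-cong M (λ i j _ → reassociate (A i) (A j)))))
                    (∑-cong-mod L (λ i i<L → mod-trans (*-congˡ-mod (A i * A i) (*-cong-mod (reflect i<L) (reflect i<L)))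
                                                        (mod-reflexive (sign² (A i))))) ⟩
    + 2 * t₂₂ + s₄ L
      ∎
    where open mod-Reasoning m
          sign⁴ : ∀ a b → - a * - a * (- b * - b) ≡ a * a * (b * b)
          sign⁴ = solve-∀
          reassociate : ∀ a b → a * a * (b * b) ≡ a * a * b * b
          reassociate = solve-∀
          sign² : ∀ a → a * a * (- a * - a) ≡ a * a * a * a
          sign² = solve-∀

  ∑1≡ℓ : ∑[ i < L ] 1ℤ ≡ ℓ
  ∑1≡ℓ = trans (∑-const L 1ℤ) (trans (ℤP.*-identityʳ (+ L)) (sym ℓ≡L))

  square₂₀ : s₂ L * ℓ ≡ + 2 * t₂ + s₂ L mod m
  square₂₀ = begin
    s₂ L * ℓ
      ≡⟨ cong (s₂ L *_) ∑1≡ℓ ⟨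
    s₂ L * (∑[ i < L ] 1ℤ)
      ≈⟨ ∑*∑-even (λ i → A i * A i) (λ _ → 1ℤ) (λ i j i≤M j≤M → let rᵢ = reflection i i≤M in
           *-congʳ-mod 1ℤ (mod-trans (*-cong-mod rᵢ rᵢ) (mod-reflexive (sign² (A i))))) ⟩
    + 2 * ∑△ M (λ i j _ → A i * A i * 1ℤ) + (∑[ i < L ] A i * A i * 1ℤ)
      ≡⟨ cong₂ (λ x y → + 2 * x + y) (∑△-cong M (λ i _ _ → ℤP.*-identityʳ (A i * A i)))
                                      (∑-cong L (λ i _ → ℤP.*-identityʳ (A i * A i))) ⟩
    + 2 * t₂ + s₂ L
      ∎
    where open mod-Reasoning m
          sign² : ∀ a → - a * - a ≡ a * a
          sign² = solve-∀

  square₀₀ : ℓ * ℓ ≡ + 2 * t₀ + ℓ mod m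
  square₀₀ = begin
    ℓ * ℓ
      ≡⟨ cong₂ _*_ ∑1≡ℓ ∑1≡ℓ ⟨
    (∑[ i < L ] 1ℤ) * (∑[ i < L ] 1ℤ)
      ≈⟨ ∑*∑-even (λ _ → 1ℤ) (λ _ → 1ℤ) (λ _ _ _ _ → mod-refl) ⟩
    + 2 * t₀ + (∑[ i < L ] 1ℤ)
      ≡⟨ cong (λ z → + 2 * t₀ + z) ∑1≡ℓ ⟩
    + 2 * t₀ + ℓ
      ∎
    where open mod-Reasoning m

  s₂-relation : m ∣ + 3 * s₂ L + D * ℓ * + M
  s₂-relation = ∣-subst (combination (s₁ L) (s₂ L) t₁₁ t₀ D (+ M))
    (∣m∣n⇒∣m+n (∣m∣n⇒∣m+n (∣m∣n⇒∣m+n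
      (∣n⇒∣m*n (+ 3) (∣-difference square₁₁))
      (∣n⇒∣m*n (- + 3) (∣n⇒∣m*n (s₁ L) s₁-vanishes)))
      (∣n⇒∣m*n (+ 2) (mod-0⇒∣ triple-relation₀)))
      (∣n⇒∣m*n D (∣-difference square₀₀)))
    where
      combination : ∀ s₁ s₂ t₁₁ t₀ D M →
        + 3 * (s₁ * s₁ - (+ 2 * t₁₁ - s₂)) + - + 3 * (s₁ * s₁) + + 2 * (+ 3 * t₁₁ + D * t₀)
          + D * ((1ℤ + M) * (1ℤ + M) - (+ 2 * t₀ + (1ℤ + M)))
        ≡ + 3 * s₂ + D * (1ℤ + M) * M
      combination = solve-∀

  s₄-relation : m ∣ + 5 * s₄ L - (s₂ L * s₂ L + D * s₂ L - + 2 * D * + M * s₂ L)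
  s₄-relation = ∣-subst (combination (s₁ L) (s₂ L) (s₃ L) (s₄ L) t₁₁ t₂ t₃₁ t₂₂ t₂₁₁ D (+ M))
    (∣m∣n⇒∣m+n (∣m∣n⇒∣m+n (∣m∣n⇒∣m+n (∣m∣n⇒∣m+n (∣m∣n⇒∣m+n (∣m∣n⇒∣m+n (∣m∣n⇒∣m+n
      (∣n⇒∣m*n (- 1ℤ) (∣-difference square₂₂))
      (∣n⇒∣m*n (- + 2) (mod-0⇒∣ triple-relation₁₁)))
      (∣n⇒∣m*n (+ 4) (mod-0⇒∣ triple-relation₂)))
      (∣n⇒∣m*n (+ 4) (∣-difference square₃₁)))
      (∣n⇒∣m*n (- + 4) (∣m⇒∣m*n (s₁ L) s₃-vanishes)))
      (∣n⇒∣m*n (- D) (∣-difference square₁₁)))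
      (∣n⇒∣m*n D (∣n⇒∣m*n (s₁ L) s₁-vanishes)))
      (∣n⇒∣m*n (+ 2 * D) (∣-difference square₂₀)))
    where
      combination : ∀ s₁ s₂ s₃ s₄ t₁₁ t₂ t₃₁ t₂₂ t₂₁₁ D M →
        - 1ℤ * (s₂ * s₂ - (+ 2 * t₂₂ + s₄)) + - + 2 * (t₂₂ + + 2 * t₂₁₁ + D * t₁₁)
          + + 4 * (+ 2 * t₃₁ + t₂₁₁ + D * t₂) + + 4 * (s₃ * s₁ - (+ 2 * t₃₁ - s₄)) + - + 4 * (s₃ * s₁)
          + - D * (s₁ * s₁ - (+ 2 * t₁₁ - s₂)) + D * (s₁ * s₁) + + 2 * D * (s₂ * (1ℤ + M) - (+ 2 * t₂ + s₂))
        ≡ + 5 * s₄ - (s₂ * s₂ + D * s₂ - + 2 * D * M * s₂)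
      combination = solve-∀

  e₄-congruence : + 360 * e₄ L ≡ D * D * ℓ * + M * (+ 3 * ℓ * + M - + 12 * + M + + 6) mod m
  e₄-congruence = ≡-mod (∣-subst (begin
      _                             ≡⟨ combination (s₁ L) (s₂ L) (s₃ L) (s₄ L) D (+ M) ⟩
      + 15 * N - c₄                 ≡⟨ cong (λ z → + 15 * z - c₄) (newton₄ L) ⟨
      + 15 * (+ 24 * e₄ L) - c₄     ≡⟨ cong (_- c₄) (ℤP.*-assoc (+ 15) (+ 24) (e₄ L)) ⟨
      + 360 * e₄ L - c₄             ∎)
    (∣m∣n⇒∣m+n (∣m∣n⇒∣m+n
      (∣m⇒∣m*n (s₁ L * s₁ L * s₁ L - + 6 * s₁ L * s₂ L + + 8 * s₃ L) (∣n⇒∣m*n (+ 15) s₁-vanishes))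
      (∣n⇒∣m*n (- + 18) s₄-relation))
      (∣m⇒∣m*n (+ 3 * (+ 3 * s₂ L + D * ℓ * + M) - + 6 * D * ℓ * + M + D * (+ 12 * + M - + 6)) s₂-relation)))
    where
      open ≡-Reasoning
      c₄ N : ℤ
      c₄ = D * D * ℓ * + M * (+ 3 * ℓ * + M - + 12 * + M + + 6)
      N = s₁ L * s₁ L * s₁ L * s₁ L - + 6 * s₁ L * s₁ L * s₂ L + + 3 * s₂ L * s₂ L + + 8 * s₁ L * s₃ L - + 6 * s₄ L
      combination : ∀ s₁ s₂ s₃ s₄ D M →
        + 15 * s₁ * (s₁ * s₁ * s₁ - + 6 * s₁ * s₂ + + 8 * s₃) + - + 18 * (+ 5 * s₄ - (s₂ * s₂ + D * s₂ - + 2 * D * M * s₂))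
          + (+ 3 * s₂ + D * (1ℤ + M) * M) * (+ 3 * (+ 3 * s₂ + D * (1ℤ + M) * M) - + 6 * D * (1ℤ + M) * M + D * (+ 12 * M - + 6))
        ≡ + 15 * (s₁ * s₁ * s₁ * s₁ - + 6 * s₁ * s₁ * s₂ + + 3 * s₂ * s₂ + + 8 * s₁ * s₃ - + 6 * s₄)
          - D * D * (1ℤ + M) * M * (+ 3 * (1ℤ + M) * M - + 12 * M + + 6)
      combination = solve-∀

  β : ℤ
  β = + 3 * s₂ L * s₂ L + + 6 * D * s₂ L - + 3 * ℓ * D * s₂ L - + 6 * s₄ L

  β-congruence : + 15 * β ≡ D * D * ℓ * + M * (+ 3 * ℓ * + M + + 3 * + M - + 9) mod m
  β-congruence = ≡-mod (∣-subst (combination (s₂ L) (s₄ L) D (+ M))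
    (∣m∣n⇒∣m+n
      (∣n⇒∣m*n (- + 18) s₄-relation)
      (∣m⇒∣m*n (+ 3 * (+ 3 * s₂ L + D * ℓ * + M) - + 6 * D * ℓ * + M + D * (+ 9 - + 3 * + M)) s₂-relation)))
    where
      combination : ∀ s₂ s₄ D M →
        - + 18 * (+ 5 * s₄ - (s₂ * s₂ + D * s₂ - + 2 * D * M * s₂))
          + (+ 3 * s₂ + D * (1ℤ + M) * M) * (+ 3 * (+ 3 * s₂ + D * (1ℤ + M) * M) - + 6 * D * (1ℤ + M) * M + D * (+ 9 - + 3 * M))
        ≡ + 15 * (+ 3 * s₂ * s₂ + + 6 * D * s₂ - + 3 * (1ℤ + M) * D * s₂ - + 6 * s₄)
          - D * D * (1ℤ + M) * M * (+ 3 * (1ℤ + M) * M + + 3 * M - + 9)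
      combination = solve-∀

-- The quotients w n below the rank of appearance

module RankOfAppearance
  (P Q : ℤ) {p : ℕ} (prime : Prime p) (7≤p : 7 ≤ p) (p∤Q : ¬ (+ p ∣ Q)) (M : ℕ)
  (p∣u : + p ∣ U P Q (suc (suc M)))
  (p∤U : ∀ i → i ≤ M → ¬ (+ p ∣ U P Q (suc i)))
  where

  open LucasIdentities P Q
  open ModPrime prime
  open LargePrime prime 7≤p

  m p² : ℤ
  m = + p
  p² = + p * + p

  u v : ℤ
  u = U P Q (suc (suc M))
  v = V P Q (suc (suc M))

  -- An inverse modulo p², with junk value 0 on multiples of p.
  inverse : ℤ → ℤ
  inverse b with + p ∣? b
  ... | yes _ = 0ℤ
  ... | no p∤b = Invertible.inverse (invertible-mod-prime² p∤b)

  inverse-correct : ∀ {b} → ¬ (+ p ∣ b) → b * inverse b ≡ 1ℤ mod p²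
  inverse-correct {b} p∤b with + p ∣? b
  ... | yes p∣b = ⊥-elim (p∤b p∣b)
  ... | no p∤b = Invertible.inverse-correct (invertible-mod-prime² p∤b)

  -- A i represents w (i + 1) = V (i + 1) / U (i + 1) modulo p².
  A : ℕ → ℤ
  A i = V P Q (suc i) * inverse (U P Q (suc i))

  U*A≡V : ∀ {i} → i ≤ M → U P Q (suc i) * A i ≡ V P Q (suc i) mod p²
  U*A≡V {i} i≤M = begin
    Uᵢ * (Vᵢ * inverse Uᵢ)   ≡⟨ identity Uᵢ Vᵢ (inverse Uᵢ) ⟩
    Vᵢ * (Uᵢ * inverse Uᵢ)   ≈⟨ *-congˡ-mod Vᵢ (inverse-correct (p∤U i i≤M)) ⟩
    Vᵢ * 1ℤ                  ≡⟨ ℤP.*-identityʳ Vᵢ ⟩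
    Vᵢ                       ∎
    where open mod-Reasoning p²
          Uᵢ Vᵢ : ℤ
          Uᵢ = U P Q (suc i)
          Vᵢ = V P Q (suc i)
          identity : ∀ u v c → u * (v * c) ≡ v * (u * c)
          identity = solve-∀

  p∤Q^ : ∀ n → ¬ (+ p ∣ Q ^ n)
  p∤Q^ zero = ∤-small 1
  p∤Q^ (suc n) = prime∤* p∤Q (p∤Q^ n)

  p∤v : ¬ (+ p ∣ v)
  p∤v p∣v = prime∤* (∤-small 4) (p∤Q^ (suc (suc M)))
    (∣-subst (V²-DU² (suc (suc M))) (∣m∣n⇒∣m-n (∣n⇒∣m*n v p∣v) (∣m⇒∣m*n u (∣n⇒∣m*n D p∣u))))

  private
    U-addition′ : ∀ a b {n} → a ℕ.+ b ≡ n → U P Q a * V P Q b + U P Q b * V P Q a ≡ + 2 * U P Q n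
    U-addition′ a b refl = sym (U-addition a b)

    V-addition′ : ∀ a b {n} → a ℕ.+ b ≡ n → V P Q a * V P Q b + D * U P Q a * U P Q b ≡ + 2 * V P Q n
    V-addition′ a b refl = sym (V-addition a b)

    p∤U* : ∀ {i j} → i ≤ M → j ≤ M → ¬ (+ p ∣ U P Q (suc i) * U P Q (suc j))
    p∤U* i≤M j≤M = prime∤* (p∤U _ i≤M) (p∤U _ j≤M)

  pairing : ∀ {i} → i ≤ M → v * (A i + A (M ∸ i)) ≡ u * (D + A i * A (M ∸ i)) mod p²
  pairing {i} i≤M = *-cancelˡ-mod (invertible-mod-prime² (prime∤* (∤-small 2) (p∤U* i≤M j≤M)))
    (mod-trans left (mod-sym right))
    where
      open mod-Reasoning p²
      j : ℕ
      j = M ∸ i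
      j≤M : j ≤ M
      j≤M = ℕP.m∸n≤m M i
      indices : suc i ℕ.+ suc j ≡ suc (suc M)
      indices = trans (ℕP.+-suc (suc i) j) (cong (λ n → suc (suc n)) (ℕP.m+[n∸m]≡n i≤M))
      Ua Ub Va Vb x y : ℤ
      Ua = U P Q (suc i)
      Ub = U P Q (suc j)
      Va = V P Q (suc i)
      Vb = V P Q (suc j)
      x = A i
      y = A j
      left : + 2 * (Ua * Ub) * (v * (x + y)) ≡ + 2 * v * (+ 2 * u) mod p²
      left = begin
        + 2 * (Ua * Ub) * (v * (x + y))            ≡⟨ identity Ua Ub v x y ⟩
        + 2 * v * (Ua * (Ub * y) + Ub * (Ua * x))  ≈⟨ *-congˡ-mod (+ 2 * v) (+-cong-mod (*-congˡ-mod Ua (U*A≡V j≤M))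
                                                                                      (*-congˡ-mod Ub (U*A≡V i≤M))) ⟩
        + 2 * v * (Ua * Vb + Ub * Va)              ≡⟨ cong (+ 2 * v *_) (U-addition′ (suc i) (suc j) indices) ⟩
        + 2 * v * (+ 2 * u)                        ∎
        where identity : ∀ Ua Ub v x y → + 2 * (Ua * Ub) * (v * (x + y)) ≡ + 2 * v * (Ua * (Ub * y) + Ub * (Ua * x))
              identity = solve-∀
      right : + 2 * (Ua * Ub) * (u * (D + x * y)) ≡ + 2 * v * (+ 2 * u) mod p²
      right = begin
        + 2 * (Ua * Ub) * (u * (D + x * y))        ≡⟨ identity Ua Ub u D x y ⟩
        + 2 * u * ((Ua * x) * (Ub * y) + D * Ua * Ub)  ≈⟨ *-congˡ-mod (+ 2 * u) (+-congʳ-mod (D * Ua * Ub)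
                                                                (*-cong-mod (U*A≡V i≤M) (U*A≡V j≤M))) ⟩
        + 2 * u * (Va * Vb + D * Ua * Ub)          ≡⟨ cong (+ 2 * u *_) (V-addition′ (suc i) (suc j) indices) ⟩
        + 2 * u * (+ 2 * v)                        ≡⟨ identity′ u v ⟩
        + 2 * v * (+ 2 * u)                        ∎
        where identity : ∀ Ua Ub u D x y → + 2 * (Ua * Ub) * (u * (D + x * y)) ≡ + 2 * u * ((Ua * x) * (Ub * y) + D * Ua * Ub)
              identity = solve-∀
              identity′ : ∀ u v → + 2 * u * (+ 2 * v) ≡ + 2 * v * (+ 2 * u)
              identity′ = solve-∀

  reflection : ∀ i → i ≤ M → A (M ∸ i) ≡ - A i mod m
  reflection i i≤M = begin
    A (M ∸ i)                  ≡⟨ identity (A i) (A (M ∸ i)) ⟩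
    (A i + A (M ∸ i)) - A i    ≈⟨ +-congʳ-mod (- A i) sum≡0 ⟩
    0ℤ - A i                   ≡⟨ ℤP.+-identityˡ (- A i) ⟩
    - A i                      ∎
    where
      open mod-Reasoning m
      identity : ∀ x y → y ≡ (x + y) - x
      identity = solve-∀
      sum≡0 : A i + A (M ∸ i) ≡ 0ℤ mod m
      sum≡0 = *-cancelˡ-mod (invertible-mod-prime p∤v)
        (mod-trans (mod-*⇒mod (pairing i≤M))
                   (mod-trans (∣⇒mod-0 (∣m⇒∣m*n _ p∣u)) (mod-reflexive (sym (ℤP.*-zeroʳ v)))))

  addition-congruence : ∀ i j → suc (i ℕ.+ j) ≤ M → A i * A j - A (suc (i ℕ.+ j)) * (A i + A j) + D ≡ 0ℤ mod p²
  addition-congruence i j n≤M = *-cancelˡ-mod (invertible-mod-prime² (prime∤* (p∤U* i≤M j≤M) (p∤U n n≤M))) (begin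
    Ua * Ub * Un * (x * y - z * (x + y) + D)
      ≡⟨ identity Ua Ub Un x y z D ⟩
    (Ua * x) * (Ub * y) * Un - (Un * z) * (Ua * (Ub * y) + Ub * (Ua * x)) + D * Ua * Ub * Un
      ≈⟨ +-congʳ-mod (D * Ua * Ub * Un) (sub-cong-mod
           (*-congʳ-mod Un (*-cong-mod (U*A≡V i≤M) (U*A≡V j≤M)))
           (*-cong-mod (U*A≡V n≤M) (+-cong-mod (*-congˡ-mod Ua (U*A≡V j≤M)) (*-congˡ-mod Ub (U*A≡V i≤M))))) ⟩
    Va * Vb * Un - Vn * (Ua * Vb + Ub * Va) + D * Ua * Ub * Un
      ≡⟨ addition-law′ (suc i) (suc j) (cong suc (ℕP.+-suc i j)) ⟩
    0ℤ
      ≡⟨ ℤP.*-zeroʳ (Ua * Ub * Un) ⟨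
    Ua * Ub * Un * 0ℤ
      ∎)
    where
      open mod-Reasoning p²
      n : ℕ
      n = suc (i ℕ.+ j)
      i≤M : i ≤ M
      i≤M = ℕP.≤-trans (ℕP.m≤m+n i j) (ℕP.<⇒≤ n≤M)
      j≤M : j ≤ M
      j≤M = ℕP.≤-trans (ℕP.m≤n+m j i) (ℕP.<⇒≤ n≤M)
      Ua Ub Un Va Vb Vn x y z : ℤ
      Ua = U P Q (suc i)
      Ub = U P Q (suc j)
      Un = U P Q (suc n)
      Va = V P Q (suc i)
      Vb = V P Q (suc j)
      Vn = V P Q (suc n)
      x = A i
      y = A j
      z = A n
      addition-law′ : ∀ a b {c} → a ℕ.+ b ≡ c →
        V P Q a * V P Q b * U P Q c - V P Q c * (U P Q a * V P Q b + U P Q b * V P Q a) + D * U P Q a * U P Q b * U P Q c ≡ 0ℤ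
      addition-law′ a b refl = addition-law a b
      identity : ∀ Ua Ub Un x y z D → Ua * Ub * Un * (x * y - z * (x + y) + D)
                   ≡ (Ua * x) * (Ub * y) * Un - (Un * z) * (Ua * (Ub * y) + Ub * (Ua * x)) + D * Ua * Ub * Un
      identity = solve-∀

  triple : ∀ i j → suc (i ℕ.+ j) ≤ M →
           A i * A j + A j * A (M ∸ suc (i ℕ.+ j)) + A (M ∸ suc (i ℕ.+ j)) * A i + D ≡ 0ℤ mod m
  triple i j n≤M = begin
    x * y + y * z̄ + z̄ * x + D      ≡⟨ identity x y z̄ D ⟩
    x * y + z̄ * (x + y) + D        ≈⟨ +-congʳ-mod D (+-congˡ-mod (x * y) (*-congʳ-mod (x + y) (reflection n n≤M))) ⟩
    x * y + - z * (x + y) + D      ≡⟨ cong (λ t → x * y + t + D) (sym (ℤP.neg-distribˡ-* z (x + y))) ⟩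
    x * y - z * (x + y) + D        ≈⟨ mod-*⇒mod (addition-congruence i j n≤M) ⟩
    0ℤ                             ∎
    where
      open mod-Reasoning m
      n : ℕ
      n = suc (i ℕ.+ j)
      x y z z̄ : ℤ
      x = A i
      y = A j
      z = A n
      z̄ = A (M ∸ n)
      identity : ∀ x y z̄ D → x * y + y * z̄ + z̄ * x + D ≡ x * y + z̄ * (x + y) + D
      identity = solve-∀

  open ReflectiveFamily prime (∤-small 2) D M A reflection triple public hiding (m)
  open NewtonIdentities A public

  private
    ∑-pair : ∀ (f : ℕ → ℤ) → ∑< L f + ∑< L f ≡ ∑[ i < L ] (f i + f (M ∸ i))
    ∑-pair f = trans (cong (λ z → ∑< L f + z) (∑-reverse L f)) (sym (∑-distrib-+ L f (λ i → f (M ∸ i))))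

  s₁-pairing : v * (s₁ L + s₁ L) ≡ u * (ℓ * D - s₂ L) mod p²
  s₁-pairing = begin
    v * (s₁ L + s₁ L)                             ≡⟨ trans (cong (v *_) (∑-pair A)) (sym (*-distribˡ-∑ L v _)) ⟩
    ∑[ i < L ] v * (A i + A (M ∸ i))              ≈⟨ ∑-cong-mod L (λ i i<L → pairing (ℕP.≤-pred i<L)) ⟩
    ∑[ i < L ] u * (D + A i * A (M ∸ i))          ≡⟨ *-distribˡ-∑ L u _ ⟩
    u * (∑[ i < L ] (D + A i * A (M ∸ i)))        ≈⟨ ∣⇒*-congˡ-mod² p∣u (∑-cong-mod L (λ i i<L →
                                                       +-congˡ-mod D (*-congˡ-mod (A i) (reflection i (ℕP.≤-pred i<L))))) ⟩
    u * (∑[ i < L ] (D + A i * - A i))            ≡⟨ cong (u *_) (trans (∑-cong L (λ i _ → identity D (A i))) (∑-distrib-- L _ _)) ⟩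
    u * ((∑[ i < L ] D) - s₂ L)                   ≡⟨ cong (λ z → u * (z - s₂ L)) (trans (∑-const L D) (cong (_* D) (sym ℓ≡L))) ⟩
    u * (ℓ * D - s₂ L)                            ∎
    where open mod-Reasoning p²
          identity : ∀ D a → D + a * - a ≡ D - a * a
          identity = solve-∀

  s₃-pairing : v * (s₃ L + s₃ L) ≡ u * (+ 3 * D * s₂ L - + 3 * s₄ L) mod p²
  s₃-pairing = begin
    v * (s₃ L + s₃ L)
      ≡⟨ trans (cong (v *_) (∑-pair (λ i → A i * A i * A i))) (sym (*-distribˡ-∑ L v _)) ⟩
    ∑[ i < L ] v * (A i * A i * A i + A (M ∸ i) * A (M ∸ i) * A (M ∸ i))
      ≈⟨ ∑-cong-mod L (λ i i<L → pointwise (ℕP.≤-pred i<L)) ⟩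
    ∑[ i < L ] u * (+ 3 * D * (A i * A i) - + 3 * (A i * A i * A i * A i))
      ≡⟨ trans (*-distribˡ-∑ L u _) (cong (u *_) (trans (∑-distrib-- L _ _)
           (cong₂ _-_ (*-distribˡ-∑ L (+ 3 * D) _) (*-distribˡ-∑ L (+ 3) _)))) ⟩
    u * (+ 3 * D * s₂ L - + 3 * s₄ L)
      ∎
    where
      open mod-Reasoning p²
      sum-of-cubes : ∀ v x y → v * (x * x * x + y * y * y) ≡ v * (x + y) * (x * x - x * y + y * y)
      sum-of-cubes = solve-∀
      reassociate : ∀ u D x y → u * (D + x * y) * (x * x - x * y + y * y) ≡ u * ((D + x * y) * (x * x - x * y + y * y))
      reassociate = solve-∀
      at-reflection : ∀ D x → (D + x * - x) * (x * x - x * - x + - x * - x) ≡ + 3 * D * (x * x) - + 3 * (x * x * x * x)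
      at-reflection = solve-∀
      pointwise : ∀ {i} → i ≤ M → v * (A i * A i * A i + A (M ∸ i) * A (M ∸ i) * A (M ∸ i))
                                  ≡ u * (+ 3 * D * (A i * A i) - + 3 * (A i * A i * A i * A i)) mod p²
      pointwise {i} i≤M = begin
        v * (x * x * x + y * y * y)                      ≡⟨ sum-of-cubes v x y ⟩
        v * (x + y) * (x * x - x * y + y * y)            ≈⟨ *-congʳ-mod (x * x - x * y + y * y) (pairing i≤M) ⟩
        u * (D + x * y) * (x * x - x * y + y * y)        ≡⟨ reassociate u D x y ⟩
        u * ((D + x * y) * (x * x - x * y + y * y))      ≈⟨ ∣⇒*-congˡ-mod² p∣u (*-cong-mod (+-congˡ-mod D (*-congˡ-mod x r))
                                                              (+-cong-mod (sub-cong-mod (mod-refl {a = x * x}) (*-congˡ-mod x r)) (*-cong-mod r r))) ⟩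
        u * ((D + x * - x) * (x * x - x * - x + - x * - x)) ≡⟨ cong (u *_) (at-reflection D x) ⟩
        u * (+ 3 * D * (x * x) - + 3 * (x * x * x * x))  ∎
        where x y : ℤ
              x = A i
              y = A (M ∸ i)
              r : A (M ∸ i) ≡ - A i mod m
              r = reflection i i≤M

  e₃-pairing : + 12 * v * e₃ L ≡ u * β mod p²
  e₃-pairing = ≡-mod (∣-subst (begin
      _                                           ≡⟨ combination (s₁ L) (s₂ L) (s₃ L) (s₄ L) u v D (+ M) ⟩
      + 2 * v * N - u * β                         ≡⟨ cong (λ z → + 2 * v * z - u * β) (newton₃ L) ⟨
      + 2 * v * (+ 6 * e₃ L) - u * β              ≡⟨ cong (_- u * β) (reassociate v (e₃ L)) ⟩
      + 12 * v * e₃ L - u * β                     ∎)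
    (∣m∣n⇒∣m+n (∣m∣n⇒∣m+n
      (∣n⇒∣m*n (+ 2 * v * s₁ L) (∣∧∣⇒*∣* s₁-vanishes s₁-vanishes))
      (∣n⇒∣m*n (- (+ 3 * s₂ L)) (∣-difference s₁-pairing)))
      (∣n⇒∣m*n (+ 2) (∣-difference s₃-pairing))))
    where
      open ≡-Reasoning
      N : ℤ
      N = s₁ L * s₁ L * s₁ L - + 3 * s₁ L * s₂ L + + 2 * s₃ L
      combination : ∀ s₁ s₂ s₃ s₄ u v D M →
        + 2 * v * s₁ * (s₁ * s₁) + - (+ 3 * s₂) * (v * (s₁ + s₁) - u * ((1ℤ + M) * D - s₂))
          + + 2 * (v * (s₃ + s₃) - u * (+ 3 * D * s₂ - + 3 * s₄))
        ≡ + 2 * v * (s₁ * s₁ * s₁ - + 3 * s₁ * s₂ + + 2 * s₃)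
          - u * (+ 3 * s₂ * s₂ + + 6 * D * s₂ - + 3 * (1ℤ + M) * D * s₂ - + 6 * s₄)
      combination = solve-∀
      reassociate : ∀ v e → + 2 * v * (+ 6 * e) ≡ + 12 * v * e
      reassociate = solve-∀

  e₃-vanishes : + p ∣ D * D * ℓ * + M * (+ 3 * ℓ * + M + + 3 * + M - + 9) → e₃ L ≡ 0ℤ mod p²
  e₃-vanishes p∣c₃ = ∣⇒mod-0 (∣-cancelˡ (invertible-mod-prime² (prime∤* (prime∤* (∤-small 3) (∤-small 4)) p∤v))
    (mod-0⇒∣ (mod-trans e₃-pairing (∣⇒mod-0 (∣∧∣⇒*∣* p∣u p∣β)))))
    where
      p∣15β : + p ∣ + 15 * β
      p∣15β = mod-0⇒∣ (mod-trans β-congruence (∣⇒mod-0 p∣c₃))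
      p∣β : + p ∣ β
      p∣β = ∣-cancel-small 5 (∣-cancel-small 3 (∣-subst (ℤP.*-assoc (+ 3) (+ 5) β) p∣15β))

-- Reduction of p-integral rationals

↥/*n≡*↧/ : ∀ a n .{{_ : ℕ.NonZero n}} → ↥ (a / n) * + n ≡ a * ↧ (a / n)
↥/*n≡*↧/ a n = begin
  ↥ q * + n              ≡⟨ cong (↥ q *_) (ℚP.↧-/ a n) ⟨
  ↥ q * (↧ q * g)        ≡⟨ identity (↥ q) (↧ q) g ⟩
  (↥ q * g) * ↧ q        ≡⟨ cong (_* ↧ q) (ℚP.↥-/ a n) ⟩
  a * ↧ q                ∎
  where open ≡-Reasoning
        q : ℚ
        q = a / n
        g : ℤ
        g = gcd a (+ n)
        identity : ∀ x y g → x * (y * g) ≡ (x * g) * y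
        identity = solve-∀

↧-∣ : ∀ (x : ℚ) a b → ↥ x * + b ≡ a * ↧ x → ↧ₙ x ℕD.∣ b
↧-∣ x@(mkℚ _ _ coprime) a b eq = Coprimality.coprime-divisor (Coprimality.sym (Coprimality.recompute coprime))
  (ℕD.divides ℤ.∣ a ∣ (begin
    ℤ.∣ ↥ x ∣ ℕ.* b      ≡⟨ ℤP.abs-* (↥ x) (+ b) ⟨
    ℤ.∣ ↥ x * + b ∣      ≡⟨ cong ℤ.∣_∣ eq ⟩
    ℤ.∣ a * ↧ x ∣        ≡⟨ ℤP.abs-* a (↧ x) ⟩
    ℤ.∣ a ∣ ℕ.* ↧ₙ x     ∎))
  where open ≡-Reasoning

module PAdicReduction
  {p : ℕ} (prime : Prime p) {m : ℤ} (p∤⇒invertible : ∀ {b} → ¬ (+ p ∣ b) → Invertible m b)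
  where

  infix 4 _≃_

  record _≃_ (x : ℚ) (r : ℤ) : Set where
    constructor reduces
    field
      p∤↧ : ¬ (p ℕD.∣ ↧ₙ x)
      ↥≡r*↧ : ↥ x ≡ r * ↧ x mod m
  open _≃_ public

  ≃-resp-mod : ∀ {x r s} → x ≃ r → r ≡ s mod m → x ≃ s
  ≃-resp-mod (reduces p∤↧ ↥≡r*↧) r≡s = reduces p∤↧ (mod-trans ↥≡r*↧ (*-congʳ-mod _ r≡s))

  /-≃ : ∀ a n .{{_ : ℕ.NonZero n}} c → ¬ (p ℕD.∣ n) → + n * c ≡ 1ℤ mod m → a / n ≃ a * c
  /-≃ a n c p∤n nc≡1 = reduces (λ p∣↧ → p∤n (ℕD.∣-trans p∣↧ (↧-∣ q a n (↥/*n≡*↧/ a n)))) (begin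
    ↥ q                ≡⟨ ℤP.*-identityʳ (↥ q) ⟨
    ↥ q * 1ℤ           ≈⟨ *-congˡ-mod (↥ q) nc≡1 ⟨
    ↥ q * (+ n * c)    ≡⟨ ℤP.*-assoc (↥ q) (+ n) c ⟨
    ↥ q * + n * c      ≡⟨ cong (_* c) (↥/*n≡*↧/ a n) ⟩
    a * ↧ q * c        ≡⟨ identity a (↧ q) c ⟩
    a * c * ↧ q        ∎)
    where open mod-Reasoning m
          q : ℚ
          q = a / n
          identity : ∀ a d c → a * d * c ≡ a * c * d
          identity = solve-∀

  private
    p∤↧* : ∀ {x y r s} → x ≃ r → y ≃ s → ¬ (p ℕD.∣ ↧ₙ x ℕ.* ↧ₙ y)
    p∤↧* x≃r y≃s p∣ with euclidsLemma _ _ prime p∣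
    ... | inj₁ p∣↧x = p∤↧ x≃r p∣↧x
    ... | inj₂ p∣↧y = p∤↧ y≃s p∣↧y

    fraction-≃ : ∀ N {x y r s} t → x ≃ r → y ≃ s → N ≡ t * (↧ x * ↧ y) mod m →
                 N / (↧ₙ x ℕ.* ↧ₙ y) ≃ t
    fraction-≃ N {x} {y} t x≃r y≃s N≡t↧↧ with p∤⇒invertible {+ (↧ₙ x ℕ.* ↧ₙ y)} (λ p∣ → p∤↧* x≃r y≃s (∣⇒∣ᵤ p∣))
    ... | invertible c dc≡1 = ≃-resp-mod (/-≃ N (↧ₙ x ℕ.* ↧ₙ y) c (p∤↧* x≃r y≃s) dc≡1) (begin
      N * c                    ≈⟨ *-congʳ-mod c N≡t↧↧ ⟩
      t * (↧ x * ↧ y) * c      ≡⟨ cong (λ d → t * d * c) (ℤP.pos-* (↧ₙ x) (↧ₙ y)) ⟨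
      t * + (↧ₙ x ℕ.* ↧ₙ y) * c ≡⟨ ℤP.*-assoc t _ c ⟩
      t * (+ (↧ₙ x ℕ.* ↧ₙ y) * c) ≈⟨ *-congˡ-mod t dc≡1 ⟩
      t * 1ℤ                   ≡⟨ ℤP.*-identityʳ t ⟩
      t                        ∎)
      where open mod-Reasoning m

  +-≃ : ∀ {x y r s} → x ≃ r → y ≃ s → x ℚ.+ y ≃ r + s
  +-≃ {x@(mkℚ _ _ _)} {y@(mkℚ _ _ _)} {r} {s} x≃r y≃s = fraction-≃ _ (r + s) x≃r y≃s (begin
    ↥ x * ↧ y + ↥ y * ↧ x                  ≈⟨ +-cong-mod (*-congʳ-mod (↧ y) (↥≡r*↧ x≃r)) (*-congʳ-mod (↧ x) (↥≡r*↧ y≃s)) ⟩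
    r * ↧ x * ↧ y + s * ↧ y * ↧ x          ≡⟨ identity r s (↧ x) (↧ y) ⟩
    (r + s) * (↧ x * ↧ y)                  ∎)
    where open mod-Reasoning m
          identity : ∀ r s dx dy → r * dx * dy + s * dy * dx ≡ (r + s) * (dx * dy)
          identity = solve-∀

  *-≃ : ∀ {x y r s} → x ≃ r → y ≃ s → x ℚ.* y ≃ r * s
  *-≃ {x@(mkℚ _ _ _)} {y@(mkℚ _ _ _)} {r} {s} x≃r y≃s = fraction-≃ _ (r * s) x≃r y≃s (begin
    ↥ x * ↥ y                  ≈⟨ *-cong-mod (↥≡r*↧ x≃r) (↥≡r*↧ y≃s) ⟩
    r * ↧ x * (s * ↧ y)        ≡⟨ identity r s (↧ x) (↧ y) ⟩
    r * s * (↧ x * ↧ y)        ∎)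
    where open mod-Reasoning m
          identity : ∀ r s dx dy → r * dx * (s * dy) ≡ r * s * (dx * dy)
          identity = solve-∀

  neg-≃ : ∀ {x r} → x ≃ r → ℚ.- x ≃ - r
  neg-≃ {x} {r} (reduces p∤↧ ↥≡r*↧) = reduces (subst (λ d → ¬ (p ℕD.∣ d)) (sym ↧ₙ-neg) p∤↧) (begin
    ↥ (ℚ.- x)          ≡⟨ ℚP.↥-neg x ⟩
    - ↥ x              ≈⟨ neg-cong-mod ↥≡r*↧ ⟩
    - (r * ↧ x)        ≡⟨ ℤP.neg-distribˡ-* r (↧ x) ⟩
    - r * ↧ x          ≡⟨ cong (- r *_) (ℚP.↧-neg x) ⟨
    - r * ↧ (ℚ.- x)    ∎)
    where open mod-Reasoning m
          ↧ₙ-neg : ↧ₙ (ℚ.- x) ≡ ↧ₙ x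
          ↧ₙ-neg = cong ℤ.∣_∣ (ℚP.↧-neg x)

  private
    p∤1 : ¬ (p ℕD.∣ 1)
    p∤1 p∣1 = ¬prime[1] (subst Prime (ℕD.∣1⇒≡1 p∣1) prime)

  0ℚ-≃ : 0ℚ ≃ 0ℤ
  0ℚ-≃ = reduces p∤1 mod-refl

  /1-≃ : ∀ a → a / 1 ≃ a
  /1-≃ a = ≃-resp-mod (/-≃ a 1 1ℤ p∤1 mod-refl) (mod-reflexive (ℤP.*-identityʳ a))

  divℤ-≃ : ∀ a b c → ¬ (+ p ∣ b) → b * c ≡ 1ℤ mod m → divℤ a b ≃ a * c
  divℤ-≃ a (+ zero) c p∤b _ = ⊥-elim (p∤b (divides 0ℤ refl))
  divℤ-≃ a +[1+ n ] c p∤b bc≡1 = /-≃ a (suc n) c (λ p∣ → p∤b (∣ᵤ⇒∣ p∣)) bc≡1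
  divℤ-≃ a -[1+ n ] c p∤b bc≡1 = ≃-resp-mod (/-≃ (- a) (suc n) (- c) (λ p∣ → p∤b (∣ᵤ⇒∣ p∣))
      (mod-trans (mod-reflexive (sign-swap (+ suc n) c)) bc≡1))
    (mod-reflexive (sign² a c))
    where sign-swap : ∀ n c → n * - c ≡ - n * c
          sign-swap = solve-∀
          sign² : ∀ a c → - a * - c ≡ a * c
          sign² = solve-∀

  S-≃ : ∀ n (f : ℕ → ℚ) (g : ℕ → ℤ) → (∀ i → i < n → f (suc i) ≃ g i) → S (suc n) f ≃ ∑< n g
  S-≃ zero f g _ = 0ℚ-≃
  S-≃ (suc n) f g f≃g = +-≃ (S-≃ n f g (λ i i<n → f≃g i (ℕP.m<n⇒m<1+n i<n))) (f≃g n ℕP.≤-refl)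

  ≃⇒∣↥- : ∀ {x y r} → x ≃ r → y ≃ r → m ∣ ↥ (x ℚ.- y)
  ≃⇒∣↥- {x} {y} {r} x≃r y≃r = mod-0⇒∣ (mod-trans (↥≡r*↧ (+-≃ x≃r (neg-≃ y≃r)))
    (mod-reflexive (trans (cong (_* ↧ (x ℚ.- y)) (ℤP.+-inverseʳ r)) (ℤP.*-zeroˡ (↧ (x ℚ.- y))))))

  ≃⇒CongQ : ∀ {x y r} k → m ≡ + (p ℕ.^ k) → x ≃ r → y ≃ r → CongQ p k x y
  ≃⇒CongQ k m≡pᵏ x≃r y≃r = p∤↧ x≃r , p∤↧ y≃r , ∣⇒∣ᵤ (subst (_∣ _) m≡pᵏ (≃⇒∣↥- x≃r y≃r))

-- Maximal rank

module MaximalRankSums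
  (P Q : ℤ) {p : ℕ} (prime : Prime p) (7≤p : 7 ≤ p) (p∤Q : ¬ (+ p ∣ Q)) (M : ℕ)
  (p∣u : + p ∣ U P Q (suc (suc M)))
  (p∤U : ∀ i → i ≤ M → ¬ (+ p ∣ U P Q (suc i)))
  where

  open RankOfAppearance P Q prime 7≤p p∤Q M p∣u p∤U
  open LucasIdentities P Q using (D)
  open ModPrime prime
  open LargePrime prime 7≤p
  module Mod-p² = PAdicReduction prime invertible-mod-prime²
  module Mod-p = PAdicReduction prime invertible-mod-prime

  ρ : ℕ
  ρ = suc L

  w≃A-mod-p² : ∀ {i} → i ≤ M → w P Q (suc i) Mod-p².≃ A i
  w≃A-mod-p² {i} i≤M = Mod-p².divℤ-≃ _ _ _ (p∤U i i≤M) (inverse-correct (p∤U i i≤M))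

  w≃A-mod-p : ∀ {i} → i ≤ M → w P Q (suc i) Mod-p.≃ A i
  w≃A-mod-p {i} i≤M = Mod-p.divℤ-≃ _ _ _ (p∤U i i≤M) (mod-*⇒mod (inverse-correct (p∤U i i≤M)))

  private
    below : ∀ {i j} → j < i → i ≤ M → j ≤ M
    below j<i i≤M = ℕP.≤-trans (ℕP.<⇒≤ j<i) i≤M

  Σ111≃e₃ : Σ111 P Q ρ Mod-p².≃ e₃ L
  Σ111≃e₃ = Mod-p².≃-resp-mod
    (Mod-p².S-≃ L _ _ λ i i<L → Mod-p².S-≃ i _ _ λ j j<i → Mod-p².S-≃ j _ _ λ k k<j →
      let i≤M = ℕP.≤-pred i<L ; j≤M = below j<i i≤M ; k≤M = below k<j j≤M in
      Mod-p².*-≃ (Mod-p².*-≃ (w≃A-mod-p² k≤M) (w≃A-mod-p² j≤M)) (w≃A-mod-p² i≤M))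
    (mod-reflexive (e₃-expanded L))

  Σ1111≃e₄ : Σ1111 P Q ρ Mod-p.≃ e₄ L
  Σ1111≃e₄ = Mod-p.≃-resp-mod
    (Mod-p.S-≃ L _ _ λ i i<L → Mod-p.S-≃ i _ _ λ j j<i → Mod-p.S-≃ j _ _ λ k k<j → Mod-p.S-≃ k _ _ λ l l<k →
      let i≤M = ℕP.≤-pred i<L ; j≤M = below j<i i≤M ; k≤M = below k<j j≤M ; l≤M = below l<k k≤M in
      Mod-p.*-≃ (Mod-p.*-≃ (Mod-p.*-≃ (w≃A-mod-p l≤M) (w≃A-mod-p k≤M)) (w≃A-mod-p j≤M)) (w≃A-mod-p i≤M))
    (mod-reflexive (e₄-expanded L))

  c₃ c₄ : ℤ
  c₃ = D * D * ℓ * + M * (+ 3 * ℓ * + M + + 3 * + M - + 9)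
  c₄ = D * D * ℓ * + M * (+ 3 * ℓ * + M - + 12 * + M + + 6)

  Σ111-congruence : + p ∣ c₃ → CongQ p 2 (Σ111 P Q ρ) 0ℚ
  Σ111-congruence p∣c₃ =
    Mod-p².≃⇒CongQ 2 p*p≡p^2 (Mod-p².≃-resp-mod Σ111≃e₃ (e₃-vanishes p∣c₃)) Mod-p².0ℚ-≃
    where p*p≡p^2 : + p * + p ≡ + (p ℕ.^ 2)
          p*p≡p^2 = trans (sym (ℤP.pos-* p p)) (cong (λ n → + (p ℕ.* n)) (sym (ℕP.*-identityʳ p)))

  Σ1111-congruence : ∀ {x t} → x Mod-p.≃ t → c₄ ≡ + 360 * t mod + p → CongQ p 1 (Σ1111 P Q ρ) x
  Σ1111-congruence {t = t} x≃t c₄≡360t =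
    Mod-p.≃⇒CongQ 1 (cong +_ (sym (ℕP.*-identityʳ p))) (Mod-p.≃-resp-mod Σ1111≃e₄ e₄≡t) x≃t
    where
      p∤360 : ¬ (+ p ∣ + 360)
      p∤360 = prime∤* (∤-small 6) (prime∤* (∤-small 6) (prime∤* (∤-small 2) (∤-small 5)))
      e₄≡t : e₄ L ≡ t mod + p
      e₄≡t = *-cancelˡ-mod (invertible-mod-prime p∤360) (mod-trans e₄-congruence c₄≡360t)

  private
    ρ≡2+M : + ρ ≡ + 2 + + M
    ρ≡2+M = ℤP.pos-+ 2 M

    ∣-D²ℓM* : ∀ X → + p ∣ D ⊎ + p ∣ ℓ → + p ∣ D * D * ℓ * + M * X
    ∣-D²ℓM* X (inj₁ p∣D) = ∣m⇒∣m*n X (∣m⇒∣m*n (+ M) (∣m⇒∣m*n ℓ (∣m⇒∣m*n D p∣D)))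
    ∣-D²ℓM* X (inj₂ p∣ℓ) = ∣m⇒∣m*n X (∣m⇒∣m*n (+ M) (∣n⇒∣m*n (D * D) p∣ℓ))

  ramified-case : + p ∣ D → + p ∣ c₃ × c₄ ≡ + 360 * 0ℤ mod + p
  ramified-case p∣D = ∣-D²ℓM* _ (inj₁ p∣D) , ∣⇒mod-0 (∣-D²ℓM* _ (inj₁ p∣D))

  inert-case : + ρ ≡ + p - - + 1 → + p ∣ c₃ × c₄ ≡ + 360 * 0ℤ mod + p
  inert-case ρ≡p+1 = ∣-D²ℓM* _ (inj₂ p∣ℓ) , ∣⇒mod-0 (∣-D²ℓM* _ (inj₂ p∣ℓ))
    where
      open ≡-Reasoning
      identity : ∀ M → 1ℤ + M ≡ (+ 2 + M) - 1ℤ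
      identity = solve-∀
      identity′ : ∀ p → p - - + 1 - 1ℤ ≡ p
      identity′ = solve-∀
      ℓ≡p : ℓ ≡ + p
      ℓ≡p = begin
        1ℤ + + M          ≡⟨ identity (+ M) ⟩
        (+ 2 + + M) - 1ℤ  ≡⟨ cong (_- 1ℤ) (trans (sym ρ≡2+M) ρ≡p+1) ⟩
        + p - - + 1 - 1ℤ  ≡⟨ identity′ (+ p) ⟩
        + p               ∎
      p∣ℓ : + p ∣ ℓ
      p∣ℓ = ∣-subst (sym ℓ≡p) ∣-refl

  split-case : + ρ ≡ + p - + 1 → + p ∣ c₃ × c₄ ≡ + 360 * (D * D) mod + p
  split-case ρ≡p-1 = ∣-subst (c₃-factorisation D (+ M)) (∣m⇒∣m*n _ p∣M+3) ,
                     ≡-mod (∣-subst (c₄-factorisation D (+ M)) (∣m⇒∣m*n _ p∣M+3))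
    where
      open ≡-Reasoning
      identity : ∀ M → M + + 3 ≡ (+ 2 + M) + 1ℤ
      identity = solve-∀
      identity′ : ∀ p → p - + 1 + 1ℤ ≡ p
      identity′ = solve-∀
      M+3≡p : + M + + 3 ≡ + p
      M+3≡p = begin
        + M + + 3         ≡⟨ identity (+ M) ⟩
        (+ 2 + + M) + 1ℤ  ≡⟨ cong (_+ 1ℤ) (trans (sym ρ≡2+M) ρ≡p-1) ⟩
        + p - + 1 + 1ℤ    ≡⟨ identity′ (+ p) ⟩
        + p               ∎
      p∣M+3 : + p ∣ + M + + 3
      p∣M+3 = ∣-subst (sym M+3≡p) ∣-refl
      c₃-factorisation : ∀ D M → (M + + 3) * (D * D * (1ℤ + M) * M * (+ 3 * (M - 1ℤ)))
                                 ≡ D * D * (1ℤ + M) * M * (+ 3 * (1ℤ + M) * M + + 3 * M - + 9)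
      c₃-factorisation = solve-∀
      c₄-factorisation : ∀ D M → (M + + 3) * (D * D * (+ 3 * M * M * M - + 15 * M * M + + 42 * M - + 120))
                                 ≡ D * D * (1ℤ + M) * M * (+ 3 * (1ℤ + M) * M - + 12 * M + + 6) - + 360 * (D * D)
      c₄-factorisation = solve-∀

  maximal-rank-congruences : ∀ ε → Legendre D p ε → + ρ ≡ + p - ε →
    CongQ p 2 (Σ111 P Q ρ) 0ℚ × (ε ≢ + 1 → CongQ p 1 (Σ1111 P Q ρ) 0ℚ) × (ε ≡ + 1 → CongQ p 1 (Σ1111 P Q ρ) ((D * D) / 1))
  maximal-rank-congruences .(+ 0) (leg-zero p∣D) _ =
    let p∣c₃ , c₄≡0 = ramified-case (∣ᵤ⇒∣ p∣D) in
    Σ111-congruence p∣c₃ , (λ _ → Σ1111-congruence Mod-p.0ℚ-≃ c₄≡0) , λ ()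
  maximal-rank-congruences .(+ 1) (leg-plus _ _) ρ≡p-1 =
    let p∣c₃ , c₄≡360D² = split-case ρ≡p-1 in
    Σ111-congruence p∣c₃ , (λ ε≢1 → ⊥-elim (ε≢1 refl)) , λ _ → Σ1111-congruence (Mod-p./1-≃ (D * D)) c₄≡360D²
  maximal-rank-congruences .(- + 1) (leg-minus _ _) ρ≡p+1 =
    let p∣c₃ , c₄≡0 = inert-case ρ≡p+1 in
    Σ111-congruence p∣c₃ , (λ _ → Σ1111-congruence Mod-p.0ℚ-≃ c₄≡0) , λ ()

lemma14 : (P Q : ℤ) → Q ≢ + 0 → (p : ℕ) → Prime p → 7 ≤ p
    → ¬ ((+ p) ℤD.∣ Q) → (ε : ℤ) → Legendre (P * P - (+ 4) * Q) p ε
    → (ρ : ℕ) → IsRank P Q p ρ → + ρ ≡ + p - ε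
    → CongQ p 2 (Σ111 P Q ρ) 0ℚ
      × (ε ≢ + 1 → CongQ p 1 (Σ1111 P Q ρ) 0ℚ)
      × (ε ≡ + 1 → CongQ p 1 (Σ1111 P Q ρ)
                     (((P * P - (+ 4) * Q) * (P * P - (+ 4) * Q)) / 1))
lemma14 P Q _ p p-prime 7≤p p∤Q ε legendre zero (() , _)
lemma14 P Q _ p p-prime 7≤p p∤Q ε legendre (suc zero) (_ , p∣U₁ , _) _ =
  ⊥-elim (LargePrime.∤-small p-prime 7≤p 1 (∣ᵤ⇒∣ p∣U₁))
lemma14 P Q _ p p-prime 7≤p p∤Q ε legendre (suc (suc M)) (_ , p∣U[M+2] , minimal) ρ≡p-ε =
  MaximalRankSums.maximal-rank-congruences P Q p-prime 7≤p (λ p∣Q → p∤Q (∣⇒∣ᵤ p∣Q)) M (∣ᵤ⇒∣ p∣U[M+2])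
    (λ i i≤M p∣U → minimal (suc i) (s≤s z≤n) (s≤s (s≤s i≤M)) (∣⇒∣ᵤ p∣U)) ε legendre ρ≡p-ε
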